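{- Let $W$ be one of the unbranched George groups of window size $n$, namely $S_n$, $S^B_n$, $\widetilde{S}_n$, or $\widetilde{S}^C_n$. Then for every $w \in W$, \[ \$(w) = \frac{\operatorname{tvd}(w)}{2}. \]
   Context: Fix a positive integer $n$ and write $[n]=\{1,\dots,n\}$, $\pm[n]=\{\pm1,\dots,\pm n\}$. The groups are: $S_n$, all bijections of $[n]$; $S^B_n$, all bijections $w$ of $\pm[n]$ with $w(-i)=-w(i)$; $\widetilde{S}_n$, all bijections $w:\mathbb{Z}\to\mathbb{Z}$ with $w(i+n)=w(i)+n$ for all $i$ and $w(1)+\cdots+w(n)=\binom{n+1}{2}$; $\widetilde{S}^C_n$, all bijections $w:\mathbb{Z}\to\mathbb{Z}$ with $w(-i)=-w(i)$ and $w(i+2n+2)=w(i)+2n+2$ for all $i$. The total displacement is $\operatorname{tvd}(w)=\sum_{i=1}^n |w(i)-i|$. A pair $\{i,j\}$ of distinct elements of the domain is transposable for $W$ if some $w\in W$ has $w(i)=j$ and $w(j)=i$; for such a pair the transposition $\langle (i~j)\rangle$ is the involution in $W$ obtained by extending $(i~j)$ by the defining symmetries of $W$: for every map $g$ in the group generated by the defining symmetries (none for $S_n$; $i\mapsto -i$ for $S^B_n$; $i\mapsto i+n$ for $\widetilde{S}_n$; $i\mapsto -i$ and $i\mapsto i+2n+2$ for $\widetilde{S}^C_n$), it interchanges $g(i)$ and $g(j)$, and it fixes all other points. The cost of a transposition $t$ is $\$(t)=\operatorname{tvd}(t)/2$, and for arbitrary $w\in W$, $\$(w)=\min\{\$(t_1)+\cdots+\$(t_k)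 : t_1,\dots,t_k \text{ transpositions of } W,\ t_1\cdots t_k=w\}$ (the identity has cost $0$). -}

module Defs where

open import Data.Nat as ℕ using (ℕ; zero; suc)
open import Data.Nat.Combinatorics using (_C_)
open import Data.Integer as ℤ using (ℤ; +_; -_; ∣_∣)
open import Data.Bool using (Bool; true; false)
open import Data.Unit using (⊤)
open import Data.Empty using (⊥)
open import Data.Product using (Σ; _×_; _,_; ∃)
open import Data.Sum using (_⊎_)
open import Data.List using (List; []; _∷_; map; foldr; upTo)
open import Relation.Binary.PropositionalEquality using (_≡_; _≢_)

data GeorgeType : Set where
  typeA  : GeorgeType
  typeB  : GeorgeType
  typeÃ  : GeorgeType
  typeC̃  : GeorgeType

Domain : GeorgeType → ℕ → ℤ → Set
Domain typeA n x = (+ 1 ℤ.≤ x) × (x ℤ.≤ + n)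
Domain typeB n x = (1 ℕ.≤ ∣ x ∣) × (∣ x ∣ ℕ.≤ n)
Domain typeÃ n x = ⊤
Domain typeC̃ n x = ⊤

sumℤ : ℕ → (ℤ → ℤ) → ℤ
sumℤ n f = foldr ℤ._+_ (+ 0) (map (λ k → f (+ suc k)) (upTo n))

Symmetric : GeorgeType → ℕ → (ℤ → ℤ) → Set
Symmetric typeA n f = ⊤
Symmetric typeB n f = ∀ i → f (- i) ≡ - f i
Symmetric typeÃ n f =
  (∀ i → f (i ℤ.+ + n) ≡ f i ℤ.+ + n) × (sumℤ n f ≡ + (suc n C 2))
Symmetric typeC̃ n f =
  (∀ i → f (- i) ≡ - f i) ×
  (∀ i → f (i ℤ.+ + (2 ℕ.* n ℕ.+ 2)) ≡ f i ℤ.+ + (2 ℕ.* n ℕ.+ 2))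

-- Membership of a map ℤ → ℤ in W.  A bijection of the domain D is
-- encoded as a bijection of ℤ that fixes every point outside D.
record InW (T : GeorgeType) (n : ℕ) (f : ℤ → ℤ) : Set where
  field
    inv       : ℤ → ℤ
    inv-left  : ∀ x → inv (f x) ≡ x
    inv-right : ∀ x → f (inv x) ≡ x
    fixOutside : ∀ x → (Domain T n x → ⊥) → f x ≡ x
    symmetric : Symmetric T n f

-- The group generated by the defining symmetries, and its action on ℤ.
SymGroup : GeorgeType → Set
SymGroup typeA = ⊤
SymGroup typeB = Bool
SymGroup typeÃ = ℤ
SymGroup typeC̃ = Bool × ℤ

act : (T : GeorgeType) → ℕ → SymGroup T → ℤ → ℤ
act typeA n _ x = x
act typeB n false x = x
act typeB n true x = - x
act typeÃ n k x = x ℤ.+ k ℤ.* + n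
act typeC̃ n (false , k) x = x ℤ.+ k ℤ.* + (2 ℕ.* n ℕ.+ 2)
act typeC̃ n (true , k) x = - x ℤ.+ k ℤ.* + (2 ℕ.* n ℕ.+ 2)

Transposable : GeorgeType → ℕ → ℤ → ℤ → Set
Transposable T n i j =
  (i ≢ j) × Domain T n i × Domain T n j ×
  Σ (ℤ → ℤ) (λ w → InW T n w × (w i ≡ j) × (w j ≡ i))

IsTranspositionOf : GeorgeType → ℕ → ℤ → ℤ → (ℤ → ℤ) → Set
IsTranspositionOf T n i j t =
  (∀ g → (t (act T n g i) ≡ act T n g j) × (t (act T n g j) ≡ act T n g i)) ×
  (∀ x → (∀ g → (x ≢ act T n g i) × (x ≢ act T n g j)) → t x ≡ x)

IsTransposition : GeorgeType → ℕ → (ℤ → ℤ) → Set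
IsTransposition T n t =
  Σ ℤ λ i → Σ ℤ λ j → Transposable T n i j × IsTranspositionOf T n i j t

Transposition : GeorgeType → ℕ → Set
Transposition T n = Σ (ℤ → ℤ) (IsTransposition T n)

tvd : ℕ → (ℤ → ℤ) → ℕ
tvd n w = foldr ℕ._+_ 0 (map (λ k → ∣ w (+ suc k) ℤ.- + suc k ∣) (upTo n))

product : {T : GeorgeType} {n : ℕ} → List (Transposition T n) → ℤ → ℤ
product [] x = x
product ((t , _) ∷ ts) x = t (product ts x)

-- Σ_i tvd(t_i) = 2 · Σ_i $(t_i).
doubledCostSum : {T : GeorgeType} {n : ℕ} → List (Transposition T n) → ℕ
doubledCostSum {n = n} [] = 0
doubledCostSum {n = n} ((t , _) ∷ ts) = tvd n t ℕ.+ doubledCostSum ts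

IsFactorization : (T : GeorgeType) (n : ℕ) → (ℤ → ℤ) → List (Transposition T n) → Set
IsFactorization T n w ts = ∀ x → product ts x ≡ w x

-- "2·$(w) = c": c is the minimum of 2·($(t₁)+⋯+$(t_k)) over all factorizations.
DoubledCost : (T : GeorgeType) (n : ℕ) → (ℤ → ℤ) → ℕ → Set
DoubledCost T n w c =
  (Σ (List (Transposition T n)) λ ts → IsFactorization T n w ts × (doubledCostSum ts ≡ c)) ×
  (∀ ts → IsFactorization T n w ts → c ℕ.≤ doubledCostSum ts)

-- Both bounds go through the total displacement. Displacement is subadditive under
-- composition of admissible maps (reindex the window by the inner factor, then use the
-- triangle inequality), so every factorisation into transpositions costs at least
-- tvd(w)/2. Conversely, if w ≠ 1, then comparing segment sums of w with those of the
-- identity forces a crossing p < q with w q ≤ p and q ≤ w p. For t = ⟨(p q)⟩, w carries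
-- every point of the orbits of p and q monotonically through its image under t, so
-- tvd(w t) + tvd(t) = tvd(w), and induction on tvd(w) yields a factorisation of cost
-- tvd(w)/2.

module Submission where

open import Defs
open import Algebra.Bundles using (AbelianGroup; CommutativeMonoid)
open import Data.Bool using (Bool; true; false; not; _xor_)
open import Data.Empty using (⊥; ⊥-elim)
open import Data.Fin using (Fin; toℕ; fromℕ<)
import Data.Fin.Properties as Finₚ
open import Data.Fin.Permutation using (Permutation; permutation; _⟨$⟩ʳ_)
open import Data.Integer as ℤ using (ℤ; +_; -[1+_]; _+_; _-_; -_; _*_; _≤_; _<_; ∣_∣; 0ℤ; 1ℤ; -1ℤ; _/ℕ_; _%ℕ_)
open import Data.Integer.DivMod using (a≡a%ℕn+[a/ℕn]*n; n%ℕd<d)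
import Data.Integer.Properties as ℤₚ
open import Data.Integer.Tactic.RingSolver using (solve-∀)
open import Data.List using (List; []; _∷_; _++_; foldr; map; applyUpTo; upTo; length)
import Data.List.Properties as Listₚ
open import Data.List.Relation.Binary.Permutation.Propositional using (↭-sym; ↭⇒↭ₛ)
import Data.List.Relation.Binary.Permutation.Propositional.Properties as ↭ₚ
import Data.List.Relation.Binary.Permutation.Setoid.Properties as ↭ₛ
open import Data.List.Relation.Unary.All using (All; _∷_)
import Data.List.Relation.Unary.All.Properties as Allₚ
open import Data.List.Relation.Unary.Linked using (_∷_)
open import Data.List.Relation.Unary.Sorted.TotalOrder ℤₚ.≤-totalOrder using (Sorted)
open import Data.List.Relation.Unary.Unique.Propositional using (Unique; _∷_)
import Data.List.Relation.Unary.Unique.Propositional.Properties as Uniqueₚ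
open import Data.List.Sort ℤₚ.≤-decTotalOrder using (sort; sort-↭; sort-↗)
open import Data.Nat as ℕ using (ℕ; zero; suc)
open import Data.Nat.Combinatorics using (_C_; nCk+nC[k+1]≡[n+1]C[k+1]; nC1≡n)
import Data.Nat.Properties as ℕₚ
open import Data.Product using (Σ; _×_; _,_; proj₁; proj₂)
open import Data.Sum using (_⊎_; inj₁; inj₂)
open import Data.Unit using (⊤; tt)
open import Function using (_∘_)
open import Relation.Binary.Definitions using (tri<; tri≈; tri>)
open import Relation.Binary.PropositionalEquality
  using (_≡_; _≢_; refl; sym; trans; cong; cong₂; subst; subst₂; module ≡-Reasoning; setoid)
open import Relation.Nullary using (Dec; yes; no; ¬_; ¬?)
open import Relation.Nullary.Decidable using (_×-dec_; decidable-stable)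
open import Relation.Unary using (Decidable)

open import Algebra.Properties.Group (AbelianGroup.group ℤₚ.+-0-abelianGroup) using (∙-cancelˡ; ∙-cancelʳ)

≤-by : ∀ {e i j} → 0ℤ ≤ e → e ≡ j - i → i ≤ j
≤-by 0≤e refl = ℤₚ.0≤i-j⇒j≤i 0≤e

<-by : ∀ {e i j} → 0ℤ ≤ e → e ≡ j - i - 1ℤ → i < j
<-by {i = i} {j} 0≤e refl = ℤₚ.suc[i]≤j⇒i<j (ℤₚ.0≤i-j⇒j≤i (subst (0ℤ ≤_) (lemma i j) 0≤e))
  where
  lemma : ∀ i j → j - i - 1ℤ ≡ j - (1ℤ + i)
  lemma = solve-∀

⊥-by : ∀ {e} k → 0ℤ ≤ e → e ≡ -[1+ k ] → ⊥
⊥-by k () refl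

0≤+ : ∀ m → 0ℤ ≤ + m
0≤+ m = ℤ.+≤+ ℕ.z≤n

0≤-+ : ∀ {i j} → 0ℤ ≤ i → 0ℤ ≤ j → 0ℤ ≤ i + j
0≤-+ = ℤₚ.+-mono-≤

i<j⇒0≤j-i-1 : ∀ {i j} → i < j → 0ℤ ≤ j - i - 1ℤ
i<j⇒0≤j-i-1 {i} {j} i<j = subst (0ℤ ≤_) (lemma i j) (ℤₚ.i≤j⇒0≤j-i (ℤₚ.i<j⇒suc[i]≤j i<j))
  where
  lemma : ∀ i j → j - (1ℤ + i) ≡ j - i - 1ℤ
  lemma = solve-∀

i+i≡0⇒i≡0 : ∀ i → i + i ≡ 0ℤ → i ≡ 0ℤ
i+i≡0⇒i≡0 (+ zero) _ = refl
i+i≡0⇒i≡0 (+ suc _) ()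
i+i≡0⇒i≡0 -[1+ _ ] ()

Window : ℕ → ℤ → Set
Window n x = (+ 1 ≤ x) × (x ≤ + n)

window-pos : ∀ {n} x → Window n x → Σ ℕ λ j → (x ≡ + suc j) × (j ℕ.< n)
window-pos (+ zero) (ℤ.+≤+ () , _)
window-pos (+ suc j) (_ , ℤ.+≤+ j<n) = j , refl , j<n
window-pos -[1+ _ ] (() , _)

+suc∈Window : ∀ {n j} → j ℕ.< n → Window n (+ suc j)
+suc∈Window j<n = ℤ.+≤+ (ℕ.s≤s ℕ.z≤n) , ℤ.+≤+ j<n

-- Finite sums

module MonoidSums {a ℓ} (M : CommutativeMonoid a ℓ) where

  open CommutativeMonoid M using (_≈_; _∙_; ε; ∙-congˡ; identityˡ; commutativeSemigroup)
    renaming (Carrier to C; sym to ≈-sym; trans to ≈-trans; setoid to ≈-setoid)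
  open import Algebra.Properties.CommutativeMonoid.Sum M using (sum; sum-permute; sum-cong-≗)
  open import Algebra.Properties.CommutativeSemigroup commutativeSemigroup using (interchange)

  Σ< : ℕ → (ℕ → C) → C
  Σ< zero f = ε
  Σ< (suc m) f = f 0 ∙ Σ< m (f ∘ suc)

  Σ<-cong : ∀ m {f g : ℕ → C} → (∀ k → k ℕ.< m → f k ≡ g k) → Σ< m f ≡ Σ< m g
  Σ<-cong zero f≡g = refl
  Σ<-cong (suc m) f≡g = cong₂ _∙_ (f≡g 0 ℕ.z<s) (Σ<-cong m (λ k k<m → f≡g (suc k) (ℕ.s<s k<m)))

  Σ<-distrib : ∀ m (f g : ℕ → C) → Σ< m (λ k → f k ∙ g k) ≈ Σ< m f ∙ Σ< m g
  Σ<-distrib zero f g = ≈-sym (identityˡ ε)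
  Σ<-distrib (suc m) f g =
    ≈-trans (∙-congˡ (Σ<-distrib m (f ∘ suc) (g ∘ suc))) (interchange (f 0) (g 0) _ _)

  foldr-applyUpTo : ∀ m (f : ℕ → C) → foldr _∙_ ε (applyUpTo f m) ≡ Σ< m f
  foldr-applyUpTo zero f = refl
  foldr-applyUpTo (suc m) f = cong (f 0 ∙_) (foldr-applyUpTo m (f ∘ suc))

  foldr-map-upTo : ∀ m (f : ℕ → C) → foldr _∙_ ε (map f (upTo m)) ≡ Σ< m f
  foldr-map-upTo m f = trans (cong (foldr _∙_ ε) (Listₚ.map-upTo f m)) (foldr-applyUpTo m f)

  Σ<≡sum : ∀ m (f : ℕ → C) → Σ< m f ≡ sum {m} (f ∘ toℕ)
  Σ<≡sum zero f = refl
  Σ<≡sum (suc m) f = cong (f 0 ∙_) (Σ<≡sum m (f ∘ suc))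

  module _ {n} (σ τ : ℤ → ℤ)
           (σ-window : ∀ i → Window n i → Window n (σ i)) (τ-window : ∀ i → Window n i → Window n (τ i))
           (τ∘σ : ∀ i → Window n i → τ (σ i) ≡ i) (σ∘τ : ∀ i → Window n i → σ (τ i) ≡ i) where

    private
      ι : Fin n → ℤ
      ι k = + suc (toℕ k)

      toFin : ∀ x → Window n x → Fin n
      toFin x w = fromℕ< (proj₂ (proj₂ (window-pos x w)))

      ι-toFin : ∀ x w → ι (toFin x w) ≡ x
      ι-toFin x w with window-pos x w
      ... | j , x≡ , j<n = trans (cong (λ k → + suc k) (Finₚ.toℕ-fromℕ< j<n)) (sym x≡)

      toFin-ι : ∀ {x} w k → x ≡ ι k → toFin x w ≡ k
      toFin-ι w k x≡ = Finₚ.toℕ-injective (ℕₚ.suc-injective (ℤₚ.+-injective (trans (ι-toFin _ w) x≡)))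

      ιw : ∀ k → Window n (ι k)
      ιw k = +suc∈Window (Finₚ.toℕ<n k)

      π : Permutation n n
      π = permutation (λ k → toFin (σ (ι k)) (σ-window _ (ιw k))) (λ k → toFin (τ (ι k)) (τ-window _ (ιw k)))
            (λ k → toFin-ι _ k (trans (cong σ (ι-toFin _ _)) (σ∘τ _ (ιw k))))
            (λ k → toFin-ι _ k (trans (cong τ (ι-toFin _ _)) (τ∘σ _ (ιw k))))

    Σ<-permute-window : (φ : ℤ → C) → Σ< n (λ k → φ (+ suc k)) ≈ Σ< n (λ k → φ (σ (+ suc k)))
    Σ<-permute-window φ = begin
      Σ< n (λ k → φ (+ suc k))                ≡⟨ Σ<≡sum n _ ⟩
      sum (φ ∘ ι)                             ≈⟨ sum-permute (φ ∘ ι) π ⟩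
      sum (λ k → φ (ι (π ⟨$⟩ʳ k)))            ≡⟨ sum-cong-≗ (λ k → cong φ (ι-toFin (σ (ι k)) (σ-window _ (ιw k)))) ⟩
      sum (λ k → φ (σ (ι k)))                 ≡⟨ Σ<≡sum n _ ⟨
      Σ< n (λ k → φ (σ (+ suc k)))            ∎
      where open import Relation.Binary.Reasoning.Setoid ≈-setoid

open MonoidSums ℤₚ.+-0-commutativeMonoid using ()
  renaming (Σ< to Σℤ; Σ<-cong to Σℤ-cong; Σ<-distrib to Σℤ-distrib; foldr-applyUpTo to foldr-applyUpToℤ;
            foldr-map-upTo to foldr-map-upToℤ)

Σℤ-neg : ∀ m (f : ℕ → ℤ) → Σℤ m (λ k → - f k) ≡ - Σℤ m f
Σℤ-neg zero f = refl
Σℤ-neg (suc m) f = trans (cong (λ s → - f 0 + s) (Σℤ-neg m (f ∘ suc))) (sym (ℤₚ.neg-distrib-+ (f 0) _))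

Σℤ-snoc : ∀ m (f : ℕ → ℤ) → Σℤ (suc m) f ≡ Σℤ m f + f m
Σℤ-snoc zero f = ℤₚ.+-comm (f 0) 0ℤ
Σℤ-snoc (suc m) f = trans (cong (λ s → f 0 + s) (Σℤ-snoc m (f ∘ suc))) (sym (ℤₚ.+-assoc (f 0) _ _))

Σℤ-ones : ∀ m → Σℤ m (λ _ → 1ℤ) ≡ + m
Σℤ-ones zero = refl
Σℤ-ones (suc m) = trans (cong (λ s → 1ℤ + s) (Σℤ-ones m)) (sym (ℤₚ.pos-+ 1 m))

arithSum : ℤ → ℕ → ℤ
arithSum c m = Σℤ m (λ k → c + + k)

segmentSum : ℤ → ℕ → (ℤ → ℤ) → ℤ
segmentSum a m f = Σℤ m (λ k → f (a + + k))

+suc≡1+ : ∀ (c : ℤ) k → c + + suc k ≡ 1ℤ + c + + k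
+suc≡1+ c k = trans (cong (λ s → c + s) (ℤₚ.pos-+ 1 k)) (eq c (+ k))
  where
  eq : ∀ c k → c + (1ℤ + k) ≡ 1ℤ + c + k
  eq = solve-∀

arithSum-shift : ∀ c m → arithSum (1ℤ + c) m ≡ arithSum c m + + m
arithSum-shift c m = begin
  Σℤ m (λ k → 1ℤ + c + + k)       ≡⟨ Σℤ-cong m (λ k _ → lemma c (+ k)) ⟩
  Σℤ m (λ k → (c + + k) + 1ℤ)     ≡⟨ Σℤ-distrib m _ _ ⟩
  arithSum c m + Σℤ m (λ _ → 1ℤ)  ≡⟨ cong (λ s → arithSum c m + s) (Σℤ-ones m) ⟩
  arithSum c m + + m              ∎
  where
  open ≡-Reasoning
  lemma : ∀ c k → 1ℤ + c + k ≡ c + k + 1ℤ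
  lemma = solve-∀

arithSum-suc : ∀ c m → arithSum c (suc m) ≡ c + arithSum (1ℤ + c) m
arithSum-suc c m = cong₂ _+_ (ℤₚ.+-identityʳ c) (Σℤ-cong m (λ k _ → +suc≡1+ c k))

arithSum-snoc : ∀ c m → arithSum c (suc m) ≡ arithSum c m + (c + + m)
arithSum-snoc c m = Σℤ-snoc m (λ k → c + + k)

-- c + ⋯ + (c + m - 1) and (1 - c - m) + ⋯ + (-c) cancel term by term.
arithSum-reflect : ∀ m c → arithSum c m + arithSum (- c - + m + 1ℤ) m ≡ 0ℤ
arithSum-reflect zero c = refl
arithSum-reflect (suc m) c = begin
  arithSum c (suc m) + arithSum c′ (suc m)
    ≡⟨ cong₂ _+_ (arithSum-snoc c m) (arithSum-suc c′ m) ⟩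
  (arithSum c m + (c + + m)) + (c′ + arithSum (1ℤ + c′) m)
    ≡⟨ cong (λ d → (arithSum c m + (c + + m)) + (c′ + arithSum d m)) c′+1≡ ⟩
  (arithSum c m + (c + + m)) + (c′ + arithSum (- c - + m + 1ℤ) m)
    ≡⟨ cancel (arithSum c m) (arithSum (- c - + m + 1ℤ) m) ⟩
  arithSum c m + arithSum (- c - + m + 1ℤ) m
    ≡⟨ arithSum-reflect m c ⟩
  0ℤ ∎
  where
  open ≡-Reasoning
  c′ = - c - + suc m + 1ℤ
  c′+1≡ : 1ℤ + c′ ≡ - c - + m + 1ℤ
  c′+1≡ = trans (cong (λ s → 1ℤ + (- c - s + 1ℤ)) (ℤₚ.pos-+ 1 m)) (eq c (+ m))
    where
    eq : ∀ c m → 1ℤ + (- c - (1ℤ + m) + 1ℤ) ≡ - c - m + 1ℤ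
    eq = solve-∀
  cancel : ∀ s t → (s + (c + + m)) + (c′ + t) ≡ s + t
  cancel s t = trans (cong (λ u → (s + (c + + m)) + ((- c - u + 1ℤ) + t)) (ℤₚ.pos-+ 1 m)) (eq s t c (+ m))
    where
    eq : ∀ s t c m → (s + (c + m)) + ((- c - (1ℤ + m) + 1ℤ) + t) ≡ s + t
    eq = solve-∀

arithSum-from-1 : ∀ m → arithSum 1ℤ m ≡ + (suc m C 2)
arithSum-from-1 zero = refl
arithSum-from-1 (suc m) = begin
  arithSum 1ℤ (suc m)                  ≡⟨ arithSum-snoc 1ℤ m ⟩
  arithSum 1ℤ m + (1ℤ + + m)           ≡⟨ cong₂ _+_ (arithSum-from-1 m) (sym (ℤₚ.pos-+ 1 m)) ⟩
  + (suc m C 2) + + suc m              ≡⟨ ℤₚ.pos-+ (suc m C 2) (suc m) ⟨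
  + (suc m C 2 ℕ.+ suc m)              ≡⟨ cong +_ (ℕₚ.+-comm (suc m C 2) (suc m)) ⟩
  + (suc m ℕ.+ suc m C 2)              ≡⟨ cong (λ c → + (c ℕ.+ suc m C 2)) (nC1≡n (suc m)) ⟨
  + (suc m C 1 ℕ.+ suc m C 2)          ≡⟨ cong +_ (nCk+nC[k+1]≡[n+1]C[k+1] (suc m) 1) ⟩
  + (suc (suc m) C 2)                  ∎
  where open ≡-Reasoning

ℤ-induction : ∀ {ℓ} (Q : ℤ → Set ℓ) → Q 0ℤ → (∀ k → Q k → Q (1ℤ + k)) → (∀ k → Q (1ℤ + k) → Q k) →
              ∀ k → Q k
ℤ-induction Q q₀ up down (+ zero) = q₀
ℤ-induction Q q₀ up down (+ suc k) = up (+ k) (ℤ-induction Q q₀ up down (+ k))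
ℤ-induction Q q₀ up down -[1+ zero ] = down -1ℤ q₀
ℤ-induction Q q₀ up down -[1+ suc k ] = down -[1+ suc k ] (ℤ-induction Q q₀ up down -[1+ k ])

shift-invariant⇒constant : (S : ℤ → ℤ) → (∀ a → S (1ℤ + a) ≡ S a) → ∀ a b → S a ≡ S b
shift-invariant⇒constant S step a b = trans (to-0 a) (sym (to-0 b))
  where
  to-0 : ∀ a → S a ≡ S 0ℤ
  to-0 = ℤ-induction (λ a → S a ≡ S 0ℤ) refl (λ a Sa≡ → trans (step a) Sa≡)
                     (λ a S1+a≡ → trans (sym (step a)) S1+a≡)

sumℤ≡segmentSum : ∀ n σ → sumℤ n σ ≡ segmentSum 1ℤ n σ
sumℤ≡segmentSum n σ = foldr-map-upToℤ n (λ k → σ (+ suc k))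

segmentSum-suc : ∀ a m f → segmentSum a (suc m) f ≡ f a + segmentSum (1ℤ + a) m f
segmentSum-suc a m f = cong₂ _+_ (cong f (ℤₚ.+-identityʳ a)) (Σℤ-cong m (λ k _ → cong f (+suc≡1+ a k)))

segmentSum-snoc : ∀ a m f → segmentSum a (suc m) f ≡ segmentSum a m f + f (a + + m)
segmentSum-snoc a m f = Σℤ-snoc m (λ k → f (a + + k))

periodic-segmentSum : ∀ (d : ℤ → ℤ) P → (∀ x → d (x + + P) ≡ d x) → ∀ a b → segmentSum a P d ≡ segmentSum b P d
periodic-segmentSum d zero _ _ _ = refl
periodic-segmentSum d (suc m) periodic = shift-invariant⇒constant (λ a → segmentSum a (suc m) d) step
  where
  step : ∀ a → segmentSum (1ℤ + a) (suc m) d ≡ segmentSum a (suc m) d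
  step a = begin
    segmentSum (1ℤ + a) (suc m) d               ≡⟨ segmentSum-snoc (1ℤ + a) m d ⟩
    segmentSum (1ℤ + a) m d + d (1ℤ + a + + m)  ≡⟨ cong (λ y → segmentSum (1ℤ + a) m d + y) wrap ⟩
    segmentSum (1ℤ + a) m d + d a               ≡⟨ ℤₚ.+-comm _ (d a) ⟩
    d a + segmentSum (1ℤ + a) m d               ≡⟨ segmentSum-suc a m d ⟨
    segmentSum a (suc m) d                      ∎
    where
    open ≡-Reasoning
    wrap : d (1ℤ + a + + m) ≡ d a
    wrap = trans (cong d (sym (+suc≡1+ a m))) (periodic a)

segmentSum-reflect : ∀ m a (f : ℤ → ℤ) → segmentSum a m f ≡ segmentSum (1ℤ - (a + + m)) m (f ∘ -_)
segmentSum-reflect zero a f = refl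
segmentSum-reflect (suc m) a f = begin
  segmentSum a (suc m) f                                   ≡⟨ segmentSum-suc a m f ⟩
  f a + segmentSum (1ℤ + a) m f                            ≡⟨ cong (λ s → f a + s) (segmentSum-reflect m (1ℤ + a) f) ⟩
  f a + segmentSum (1ℤ - (1ℤ + a + + m)) m (f ∘ -_)        ≡⟨ ℤₚ.+-comm (f a) _ ⟩
  segmentSum (1ℤ - (1ℤ + a + + m)) m (f ∘ -_) + f a        ≡⟨ cong₂ (λ c x → segmentSum c m (f ∘ -_) + f x) start last ⟩
  segmentSum c m (f ∘ -_) + f (- (c + + m))                ≡⟨ segmentSum-snoc c m (f ∘ -_) ⟨
  segmentSum c (suc m) (f ∘ -_)                            ∎
  where
  open ≡-Reasoning
  c = 1ℤ - (a + + suc m)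
  start : 1ℤ - (1ℤ + a + + m) ≡ c
  start = cong (λ d → 1ℤ - d) (sym (+suc≡1+ a m))
  last : a ≡ - (c + + m)
  last = trans (eq a (+ m)) (cong (λ d → - (1ℤ - d + + m)) (sym (+suc≡1+ a m)))
    where
    eq : ∀ a m → a ≡ - (1ℤ - (1ℤ + a + m) + m)
    eq = solve-∀

-- Sums of distinct integers

listSum : List ℤ → ℤ
listSum = foldr _+_ 0ℤ

private
  arithSum≤listSum-sorted : ∀ {c x} xs → c ≤ x → Sorted (x ∷ xs) → Unique (x ∷ xs) →
                        arithSum c (length (x ∷ xs)) ≤ listSum (x ∷ xs)
  arithSum≤listSum-sorted {c} {x} [] c≤x _ _ =
    ℤₚ.+-monoˡ-≤ 0ℤ (subst (_≤ x) (sym (ℤₚ.+-identityʳ c)) c≤x)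
  arithSum≤listSum-sorted {c} {x} (y ∷ ys) c≤x (x≤y ∷ sorted) ((x≢y ∷ _) ∷ unique) =
    subst (_≤ listSum (x ∷ y ∷ ys)) (sym (arithSum-suc c (suc (length ys))))
      (ℤₚ.+-mono-≤ c≤x (arithSum≤listSum-sorted ys c+1≤y sorted unique))
    where
    c+1≤y : 1ℤ + c ≤ y
    c+1≤y = ℤₚ.i<j⇒suc[i]≤j (ℤₚ.≤-<-trans c≤x (ℤₚ.≤∧≢⇒< x≤y x≢y))

-- Sorting reduces the bound to the case of an increasing list, which dominates c, c + 1, c + 2, …
arithSum≤listSum : ∀ c xs → All (c ≤_) xs → Unique xs → arithSum c (length xs) ≤ listSum xs
arithSum≤listSum c xs c≤xs xs-unique =
  subst₂ (λ m s → arithSum c m ≤ s) (↭ₚ.↭-length sorted↭xs) sum-preserved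
    (bound (sort xs) (sort-↗ xs) (↭ₚ.All-resp-↭ (↭-sym sorted↭xs) c≤xs)
      (↭ₛ.Unique-resp-↭ (setoid ℤ) (↭⇒↭ₛ (↭-sym sorted↭xs)) xs-unique))
  where
  sorted↭xs = sort-↭ xs
  sum-preserved : listSum (sort xs) ≡ listSum xs
  sum-preserved = ↭ₛ.foldr-commMonoid (setoid ℤ) ℤₚ.+-0-isCommutativeMonoid (↭⇒↭ₛ sorted↭xs)
  bound : ∀ ys → Sorted ys → All (c ≤_) ys → Unique ys → arithSum c (length ys) ≤ listSum ys
  bound [] _ _ _ = ℤₚ.≤-refl
  bound (y ∷ ys) sorted (c≤y ∷ _) unique = arithSum≤listSum-sorted ys c≤y sorted unique

Distinct : ℕ → (ℕ → ℤ) → Set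
Distinct m f = ∀ {i j} → i ℕ.< j → j ℕ.< m → f i ≢ f j

distinct-lower : ∀ c m (f : ℕ → ℤ) → Distinct m f → (∀ {k} → k ℕ.< m → c ≤ f k) → arithSum c m ≤ Σℤ m f
distinct-lower c m f distinct c≤f =
  subst₂ (λ m′ s → arithSum c m′ ≤ s) (Listₚ.length-applyUpTo f m) (foldr-applyUpToℤ m f)
    (arithSum≤listSum c (applyUpTo f m) (Allₚ.applyUpTo⁺₁ f m c≤f) (Uniqueₚ.applyUpTo⁺₁ f m distinct))

-- The upper bound is the lower bound for - f, with the progression reflected.
distinct-upper : ∀ c m (f : ℕ → ℤ) → Distinct m f → (∀ {k} → k ℕ.< m → f k < c + + m) → Σℤ m f ≤ arithSum c m
distinct-upper c m f distinct f<c+m =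
  ≤-by (0≤-+ (ℤₚ.i≤j⇒0≤j-i lower) (ℤₚ.≤-reflexive (sym (arithSum-reflect m c)))) (eq (Σℤ m f) _ (arithSum c m))
  where
  c′ = - c - + m + 1ℤ
  bound : ∀ c m x → c + m - x - 1ℤ ≡ - x - (- c - m + 1ℤ)
  bound = solve-∀
  lower : arithSum c′ m ≤ - Σℤ m f
  lower = subst (arithSum c′ m ≤_) (Σℤ-neg m f)
    (distinct-lower c′ m (λ k → - f k) (λ i<j j<m → distinct i<j j<m ∘ ℤₚ.neg-injective)
      (λ {k} k<m → ≤-by (i<j⇒0≤j-i-1 (f<c+m k<m)) (bound c (+ m) (f k))))
  eq : ∀ s t a → (- s - t) + (a + t) ≡ a - s
  eq = solve-∀

i+j≰i : ∀ i {m} → 1 ℕ.≤ m → ¬ (i + + m ≤ i)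
i+j≰i i {m} 1≤m i+m≤i =
  ⊥-by 0 (0≤-+ (ℤₚ.i≤j⇒0≤j-i i+m≤i) (i<j⇒0≤j-i-1 (ℤ.+<+ 1≤m))) (eq i (+ m))
  where
  eq : ∀ i m → (i - (i + m)) + (m - + 0 - 1ℤ) ≡ -1ℤ
  eq = solve-∀

-- Crossings

NonRisingSegmentFrom : (ℤ → ℤ) → ℤ → Set
NonRisingSegmentFrom σ p = Σ ℕ λ m → 1 ℕ.≤ m × (segmentSum p m σ ≤ arithSum p m)

NonFallingSegmentTo : (ℤ → ℤ) → ℤ → Set
NonFallingSegmentTo σ q = Σ ℕ λ m → 1 ℕ.≤ m × (arithSum (q - + m + 1ℤ) m ≤ segmentSum (q - + m + 1ℤ) m σ)

module Crossings (σ : ℤ → ℤ) (σ-injective : ∀ {x y} → σ x ≡ σ y → x ≡ y) where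

  Inversion : Set
  Inversion = Σ ℤ λ p → Σ ℤ λ q → p < q × σ q < σ p

  Crossing : Set
  Crossing = Σ ℤ λ p → Σ ℤ λ q → p < q × σ q ≤ p × q ≤ σ p

  segment-distinct : ∀ a m → Distinct m (λ k → σ (a + + k))
  segment-distinct a m i<j _ σa+i≡σa+j = ℕₚ.<⇒≢ i<j (ℤₚ.+-injective (∙-cancelˡ a _ _ (σ-injective σa+i≡σa+j)))

  -- Distinct values all above p would sum to more than the segment itself.
  descends : ∀ {p} → p < σ p → NonRisingSegmentFrom σ p → Σ ℕ λ k → σ (p + + suc k) ≤ p
  descends {p} p<σp (m , 1≤m , segment≤) with ℕₚ.anyUpTo? (λ k → σ (p + + k) ℤₚ.≤? p) m
  ... | yes (zero , _ , σp≤p) = ⊥-elim (ℤₚ.<⇒≱ p<σp (subst (λ x → σ x ≤ p) (ℤₚ.+-identityʳ p) σp≤p))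
  ... | yes (suc k , _ , σx≤p) = k , σx≤p
  ... | no none = ⊥-elim (i+j≰i (arithSum p m) 1≤m (ℤₚ.≤-trans above segment≤))
    where
    above : arithSum p m + + m ≤ segmentSum p m σ
    above = subst (_≤ segmentSum p m σ) (arithSum-shift p m)
      (distinct-lower (1ℤ + p) m _ (segment-distinct p m)
        (λ {k} k<m → ℤₚ.i<j⇒suc[i]≤j (ℤₚ.≰⇒> (λ σx≤p → none (k , k<m , σx≤p)))))

  -- Distinct values all below q would sum to less than the segment itself.
  ascends : ∀ {q} → σ q < q → NonFallingSegmentTo σ q → Σ ℤ λ x → x < q × q ≤ σ x
  ascends {q} σq<q (m , 1≤m , ≤segment) with ℕₚ.anyUpTo? (λ k → q ℤₚ.≤? σ (q - + m + 1ℤ + + k)) m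
  ... | yes (k , k<m , q≤σx) = a + + k , x<q , q≤σx
    where
    a = q - + m + 1ℤ
    x≤q : a + + k ≤ q
    x≤q = ≤-by (i<j⇒0≤j-i-1 (ℤ.+<+ k<m)) (eq q (+ m) (+ k))
      where
      eq : ∀ q m k → m - k - 1ℤ ≡ q - (q - m + 1ℤ + k)
      eq = solve-∀
    x<q : a + + k < q
    x<q = ℤₚ.≤∧≢⇒< x≤q (λ x≡q → ℤₚ.<⇒≱ σq<q (subst (λ x → q ≤ σ x) x≡q q≤σx))
  ... | no none = ⊥-elim (i+j≰i (arithSum (a - 1ℤ) m) 1≤m (ℤₚ.≤-trans above below))
    where
    a = q - + m + 1ℤ
    a-1+m≡q : ∀ q m → q - m + 1ℤ - 1ℤ + m ≡ q
    a-1+m≡q = solve-∀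
    below : segmentSum a m σ ≤ arithSum (a - 1ℤ) m
    below = distinct-upper (a - 1ℤ) m _ (segment-distinct a m)
      (λ {k} k<m → subst (σ (a + + k) <_) (sym (a-1+m≡q q (+ m))) (ℤₚ.≰⇒> (λ q≤σx → none (k , k<m , q≤σx))))
    above : arithSum (a - 1ℤ) m + + m ≤ segmentSum a m σ
    above = subst (_≤ segmentSum a m σ) (trans (cong (λ c → arithSum c m) (eq q (+ m))) (arithSum-shift (a - 1ℤ) m)) ≤segment
      where
      eq : ∀ q m → q - m + 1ℤ ≡ 1ℤ + (q - m + 1ℤ - 1ℤ)
      eq = solve-∀

  module _ (D : ℕ) (displacement≤ : ∀ x → ∣ σ x - x ∣ ℕ.≤ D)
           (rising-balanced : ∀ {p} → p < σ p → NonRisingSegmentFrom σ p)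
           (falling-balanced : ∀ {q} → σ q < q → NonFallingSegmentTo σ q) where

    gap : Inversion → ℤ
    gap (p , q , _) = σ p - σ q

    gap<2D : ∀ I → gap I < + D + + D
    gap<2D (p , q , p<q , _) =
      <-by (0≤-+ (0≤-+ (ℤₚ.i≤j⇒0≤j-i up) (ℤₚ.i≤j⇒0≤j-i down)) (i<j⇒0≤j-i-1 p<q)) (eq (σ p) (σ q) p q (+ D))
      where
      i≤+∣i∣ : ∀ i → i ≤ + ∣ i ∣
      i≤+∣i∣ (+ _) = ℤₚ.≤-refl
      i≤+∣i∣ -[1+ _ ] = ℤ.-≤+
      up : σ p - p ≤ + D
      up = ℤₚ.≤-trans (i≤+∣i∣ _) (ℤ.+≤+ (displacement≤ p))
      down : q - σ q ≤ + D
      down = ℤₚ.≤-trans (i≤+∣i∣ _) (ℤ.+≤+ (subst (ℕ._≤ D) (ℤₚ.∣i-j∣≡∣j-i∣ (σ q) q) (displacement≤ q)))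
      eq : ∀ σp σq p q D → ((D - (σp - p)) + (D - (q - σq))) + (q - p - 1ℤ) ≡ D + D - (σp - σq) - 1ℤ
      eq = solve-∀

    p<p+suc : ∀ p k → p < p + + suc k
    p<p+suc p k = <-by (0≤+ k) (trans (ℤₚ.pos-+ 0 k) (eq p (+ k)))
      where
      eq : ∀ p k → + 0 + k ≡ p + (1ℤ + k) - p - 1ℤ
      eq = solve-∀

    inversion : ∀ y → σ y ≢ y → Inversion
    inversion y σy≢y with ℤₚ.<-cmp (σ y) y
    ... | tri≈ _ σy≡y _ = ⊥-elim (σy≢y σy≡y)
    ... | tri> _ _ y<σy =
      let k , σy′≤y = descends y<σy (rising-balanced y<σy) in
      y , y + + suc k , p<p+suc y k , ℤₚ.≤-<-trans σy′≤y y<σy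
    ... | tri< σy<y _ _ =
      let x , x<y , y≤σx = ascends σy<y (falling-balanced σy<y) in
      x , y , x<y , ℤₚ.<-≤-trans σy<y y≤σx

    crossing-or-wider : (I : Inversion) → Crossing ⊎ Σ Inversion (λ J → gap I < gap J)
    crossing-or-wider (p , q , p<q , σq<σp) with σ q ℤₚ.≤? p
    ... | no σq≰p =
      let p<σq = ℤₚ.≰⇒> σq≰p
          k , σp′≤p = descends (ℤₚ.<-trans p<σq σq<σp) (rising-balanced (ℤₚ.<-trans p<σq σq<σp))
          σp′<σq = ℤₚ.≤-<-trans σp′≤p p<σq in
      inj₂ ((p , p + + suc k , p<p+suc p k , ℤₚ.<-trans σp′<σq σq<σp) ,
            ℤₚ.+-monoʳ-< (σ p) (ℤₚ.neg-mono-< σp′<σq))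
    ... | yes σq≤p with q ℤₚ.≤? σ p
    ...   | yes q≤σp = inj₁ (p , q , p<q , σq≤p , q≤σp)
    ...   | no q≰σp =
      let σp<q = ℤₚ.≰⇒> q≰σp
          x , x<q , q≤σx = ascends (ℤₚ.<-trans σq<σp σp<q) (falling-balanced (ℤₚ.<-trans σq<σp σp<q))
          σp<σx = ℤₚ.<-≤-trans σp<q q≤σx in
      inj₂ ((x , q , x<q , ℤₚ.<-trans σq<σp σp<σx) , ℤₚ.+-monoˡ-< (- σ q) σp<σx)

    -- The gap is bounded by 2D and grows with every widening, so fuel D + D suffices.
    crossing-from : ∀ fuel (I : Inversion) → + D + + D ≤ gap I + + fuel → Crossing
    crossing-from zero I 2D≤gap = ⊥-elim (ℤₚ.<⇒≱ (gap<2D I) (subst (_ ≤_) (ℤₚ.+-identityʳ (gap I)) 2D≤gap))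
    crossing-from (suc fuel) I 2D≤gap+fuel with crossing-or-wider I
    ... | inj₁ crossing = crossing
    ... | inj₂ (J , gapI<gapJ) = crossing-from fuel J (ℤₚ.≤-trans 2D≤gap+fuel
      (subst (_≤ gap J + + fuel) (eq (gap I) (+ fuel))
        (ℤₚ.+-monoˡ-≤ (+ fuel) (ℤₚ.i<j⇒suc[i]≤j gapI<gapJ))))
      where
      eq : ∀ g f → 1ℤ + g + f ≡ g + (1ℤ + f)
      eq = solve-∀

    crossing : ∀ y → σ y ≢ y → Crossing
    crossing y σy≢y with inversion y σy≢y
    ... | I@(_ , _ , _ , σq<σp) = crossing-from (D ℕ.+ D) I (subst (_≤ gap I + + (D ℕ.+ D)) (ℤₚ.pos-+ D D)
                                    (ℤₚ.+-monoˡ-≤ (+ (D ℕ.+ D)) (ℤₚ.i≤j⇒0≤j-i (ℤₚ.<⇒≤ σq<σp))))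

  module _ {lo hi : ℤ} (σ-box : ∀ x → lo ≤ x → x ≤ hi → (lo ≤ σ x) × (σ x ≤ hi)) where

    private
      length≡ : ∀ {a b} → a ≤ b → + suc ∣ b - a ∣ ≡ 1ℤ + (b - a)
      length≡ a≤b = trans (ℤₚ.pos-+ 1 _) (cong (λ d → 1ℤ + d) (ℤₚ.0≤i⇒+∣i∣≡i (ℤₚ.i≤j⇒0≤j-i a≤b)))

    box-rising : ∀ {p} → lo ≤ p → p ≤ hi → NonRisingSegmentFrom σ p
    box-rising {p} lo≤p p≤hi = suc ∣ hi - p ∣ , ℕ.s≤s ℕ.z≤n ,
      distinct-upper p _ _ (segment-distinct p _) (λ {k} k<m → ℤₚ.≤-<-trans (proj₂ (in-box k<m)) (hi<end k))
      where
      in-box : ∀ {k} → k ℕ.< suc ∣ hi - p ∣ → (lo ≤ σ (p + + k)) × (σ (p + + k) ≤ hi)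
      in-box {k} k<m = σ-box _ (ℤₚ.≤-trans lo≤p (≤-by (0≤+ k) (eq₁ p (+ k))))
        (≤-by (subst (λ m → 0ℤ ≤ m - + k - 1ℤ) (length≡ p≤hi) (i<j⇒0≤j-i-1 (ℤ.+<+ k<m))) (eq₂ p hi (+ k)))
        where
        eq₁ : ∀ p k → k ≡ p + k - p
        eq₁ = solve-∀
        eq₂ : ∀ p hi k → 1ℤ + (hi - p) - k - 1ℤ ≡ hi - (p + k)
        eq₂ = solve-∀
      hi<end : ∀ k → hi < p + + suc ∣ hi - p ∣
      hi<end _ = <-by (0≤+ 0) (trans (eq hi p) (cong (λ m → p + m - hi - 1ℤ) (sym (length≡ p≤hi))))
        where
        eq : ∀ hi p → + 0 ≡ p + (1ℤ + (hi - p)) - hi - 1ℤ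
        eq = solve-∀

    box-falling : ∀ {q} → lo ≤ q → q ≤ hi → NonFallingSegmentTo σ q
    box-falling {q} lo≤q q≤hi = suc ∣ q - lo ∣ , ℕ.s≤s ℕ.z≤n ,
      subst (λ a → arithSum a m ≤ segmentSum a m σ) (sym start≡lo)
        (distinct-lower lo m _ (segment-distinct lo m) (λ {k} k<m → proj₁ (in-box k<m)))
      where
      m = suc ∣ q - lo ∣
      start≡lo : q - + m + 1ℤ ≡ lo
      start≡lo = trans (cong (λ l → q - l + 1ℤ) (length≡ lo≤q)) (eq q lo)
        where
        eq : ∀ q lo → q - (1ℤ + (q - lo)) + 1ℤ ≡ lo
        eq = solve-∀
      in-box : ∀ {k} → k ℕ.< m → (lo ≤ σ (lo + + k)) × (σ (lo + + k) ≤ hi)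
      in-box {k} k<m = σ-box _ (≤-by (0≤+ k) (eq₁ lo (+ k)))
        (ℤₚ.≤-trans (≤-by (subst (λ l → 0ℤ ≤ l - + k - 1ℤ) (length≡ lo≤q) (i<j⇒0≤j-i-1 (ℤ.+<+ k<m)))
                          (eq₂ lo q (+ k)))
                    q≤hi)
        where
        eq₁ : ∀ lo k → k ≡ lo + k - lo
        eq₁ = solve-∀
        eq₂ : ∀ lo q k → 1ℤ + (q - lo) - k - 1ℤ ≡ q - (lo + k)
        eq₂ = solve-∀

drift : (ℤ → ℤ) → ℤ → ℤ
drift σ x = σ x - x

segmentSum-drift : ∀ (σ : ℤ → ℤ) a m → segmentSum a m (drift σ) ≡ segmentSum a m σ - arithSum a m
segmentSum-drift σ a m =
  trans (Σℤ-distrib m (λ k → σ (a + + k)) (λ k → - (a + + k)))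
        (cong (λ s → segmentSum a m σ + s) (Σℤ-neg m (λ k → a + + k)))

module _ {σ : ℤ → ℤ} {P : ℕ} (1≤P : 1 ℕ.≤ P) (drift-free : ∀ a → segmentSum a P (drift σ) ≡ 0ℤ) where

  segmentSum-exact : ∀ a → segmentSum a P σ ≡ arithSum a P
  segmentSum-exact a = ℤₚ.i-j≡0⇒i≡j _ _ (trans (sym (segmentSum-drift σ a P)) (drift-free a))

  drift-free-rising : ∀ p → NonRisingSegmentFrom σ p
  drift-free-rising p = P , 1≤P , ℤₚ.≤-reflexive (segmentSum-exact p)

  drift-free-falling : ∀ q → NonFallingSegmentTo σ q
  drift-free-falling q = P , 1≤P , ℤₚ.≤-reflexive (sym (segmentSum-exact (q - + P + 1ℤ)))

-- Total displacement

open MonoidSums ℕₚ.+-0-commutativeMonoid using ()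
  renaming (Σ< to Σℕ; Σ<-cong to Σℕ-cong; Σ<-distrib to Σℕ-distrib; foldr-map-upTo to foldr-map-upToℕ)

Σℕ-mono : ∀ m {f g : ℕ → ℕ} → (∀ k → f k ℕ.≤ g k) → Σℕ m f ℕ.≤ Σℕ m g
Σℕ-mono zero f≤g = ℕ.z≤n
Σℕ-mono (suc m) f≤g = ℕₚ.+-mono-≤ (f≤g 0) (Σℕ-mono m (f≤g ∘ suc))

Σℕ-zero : ∀ m {f : ℕ → ℕ} → (∀ k → f k ≡ 0) → Σℕ m f ≡ 0
Σℕ-zero zero f≡0 = refl
Σℕ-zero (suc m) f≡0 = cong₂ ℕ._+_ (f≡0 0) (Σℕ-zero m (f≡0 ∘ suc))

Σℕ-term : ∀ m (f : ℕ → ℕ) {j} → j ℕ.< m → f j ℕ.≤ Σℕ m f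
Σℕ-term (suc m) f {zero} _ = ℕₚ.m≤m+n (f 0) _
Σℕ-term (suc m) f {suc j} (ℕ.s≤s j<m) = ℕₚ.≤-trans (Σℕ-term m (f ∘ suc) j<m) (ℕₚ.m≤n+m _ (f 0))

displacement : (ℤ → ℤ) → ℤ → ℕ
displacement f x = ∣ f x - x ∣

tvd≡Σℕ : ∀ n f → tvd n f ≡ Σℕ n (λ k → displacement f (+ suc k))
tvd≡Σℕ n f = foldr-map-upToℕ n (λ k → displacement f (+ suc k))

∣a-c∣≤∣a-b∣+∣b-c∣ : ∀ a b c → ∣ a - c ∣ ℕ.≤ ∣ a - b ∣ ℕ.+ ∣ b - c ∣
∣a-c∣≤∣a-b∣+∣b-c∣ a b c =
  subst (λ d → ∣ d ∣ ℕ.≤ ∣ a - b ∣ ℕ.+ ∣ b - c ∣) (eq a b c) (ℤₚ.∣i+j∣≤∣i∣+∣j∣ (a - b) (b - c))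
  where
  eq : ∀ a b c → (a - b) + (b - c) ≡ a - c
  eq = solve-∀

∣c-a∣≡∣c-b∣+∣b-a∣ : ∀ {a b c} → a ≤ b → b ≤ c → ∣ c - a ∣ ≡ ∣ c - b ∣ ℕ.+ ∣ b - a ∣
∣c-a∣≡∣c-b∣+∣b-a∣ {a} {b} {c} a≤b b≤c = ℤₚ.+-injective (begin
  + ∣ c - a ∣                    ≡⟨ ℤₚ.0≤i⇒+∣i∣≡i (ℤₚ.i≤j⇒0≤j-i (ℤₚ.≤-trans a≤b b≤c)) ⟩
  c - a                          ≡⟨ eq a b c ⟩
  (c - b) + (b - a)
    ≡⟨ cong₂ _+_ (ℤₚ.0≤i⇒+∣i∣≡i (ℤₚ.i≤j⇒0≤j-i b≤c)) (ℤₚ.0≤i⇒+∣i∣≡i (ℤₚ.i≤j⇒0≤j-i a≤b)) ⟨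
  + ∣ c - b ∣ + + ∣ b - a ∣      ≡⟨ ℤₚ.pos-+ ∣ c - b ∣ ∣ b - a ∣ ⟨
  + (∣ c - b ∣ ℕ.+ ∣ b - a ∣)    ∎)
  where
  open ≡-Reasoning
  eq : ∀ a b c → c - a ≡ (c - b) + (b - a)
  eq = solve-∀

∣c-a∣≡∣c-b∣+∣b-a∣′ : ∀ {a b c} → c ≤ b → b ≤ a → ∣ c - a ∣ ≡ ∣ c - b ∣ ℕ.+ ∣ b - a ∣
∣c-a∣≡∣c-b∣+∣b-a∣′ {a} {b} {c} c≤b b≤a = begin
  ∣ c - a ∣                ≡⟨ ℤₚ.∣i-j∣≡∣j-i∣ c a ⟩
  ∣ a - c ∣                ≡⟨ ∣c-a∣≡∣c-b∣+∣b-a∣ c≤b b≤a ⟩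
  ∣ a - b ∣ ℕ.+ ∣ b - c ∣  ≡⟨ ℕₚ.+-comm ∣ a - b ∣ ∣ b - c ∣ ⟩
  ∣ b - c ∣ ℕ.+ ∣ a - b ∣  ≡⟨ cong₂ ℕ._+_ (ℤₚ.∣i-j∣≡∣j-i∣ b c) (ℤₚ.∣i-j∣≡∣j-i∣ a b) ⟩
  ∣ c - b ∣ ℕ.+ ∣ b - a ∣  ∎
  where open ≡-Reasoning

-- Affine isometries of ℤ

signed : Bool → ℤ → ℤ
signed false x = x
signed true x = - x

signed-injective : ∀ s {a b} → signed s a ≡ signed s b → a ≡ b
signed-injective false a≡b = a≡b
signed-injective true -a≡-b = ℤₚ.neg-injective -a≡-b

signed-difference : ∀ s o a b → (signed s a + o) - (signed s b + o) ≡ signed s (a - b)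
signed-difference false = eq
  where
  eq : ∀ o a b → (a + o) - (b + o) ≡ a - b
  eq = solve-∀
signed-difference true = eq
  where
  eq : ∀ o a b → (- a + o) - (- b + o) ≡ - (a - b)
  eq = solve-∀

affine-rigid : ∀ s s′ o o′ {x y} → x ≢ y →
               signed s x + o ≡ signed s′ x + o′ → signed s y + o ≡ signed s′ y + o′ →
               ∀ z → signed s z + o ≡ signed s′ z + o′
affine-rigid false false o o′ {x} _ at-x _ z = cong (λ c → z + c) (∙-cancelˡ x _ _ at-x)
affine-rigid true true o o′ {x} _ at-x _ z = cong (λ c → - z + c) (∙-cancelˡ (- x) _ _ at-x)
affine-rigid false true o o′ {x} {y} x≢y at-x at-y z =
  ⊥-elim (x≢y (ℤₚ.i-j≡0⇒i≡j x y (i+i≡0⇒i≡0 (x - y) (begin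
    (x - y) + (x - y)                                  ≡⟨ eq₁ x y o o′ ⟩
    ((x + o) - (- x + o′)) - ((y + o) - (- y + o′))    ≡⟨ cong₂ (λ u v → (u - (- x + o′)) - (v - (- y + o′))) at-x at-y ⟩
    ((- x + o′) - (- x + o′)) - ((- y + o′) - (- y + o′)) ≡⟨ eq₂ x y o′ ⟩
    0ℤ                                                 ∎))))
  where
  open ≡-Reasoning
  eq₁ : ∀ x y o o′ → (x - y) + (x - y) ≡ ((x + o) - (- x + o′)) - ((y + o) - (- y + o′))
  eq₁ = solve-∀
  eq₂ : ∀ x y o′ → ((- x + o′) - (- x + o′)) - ((- y + o′) - (- y + o′)) ≡ 0ℤ
  eq₂ = solve-∀
affine-rigid true false o o′ x≢y at-x at-y z = sym (affine-rigid false true o′ o x≢y (sym at-x) (sym at-y) z)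

same-orientation-impossible : ∀ s o₁ o₂ {p q wp wq} → p < q → q ≤ wp → wq ≤ p →
                              signed s p + o₁ ≡ signed s q + o₂ → signed s wp + o₁ ≡ signed s wq + o₂ → ⊥
same-orientation-impossible s o₁ o₂ {p} {q} {wp} {wq} p<q q≤wp wq≤p at-p at-wp =
  ⊥-by 1 (0≤-+ (0≤-+ (ℤₚ.i≤j⇒0≤j-i q≤wp) (i<j⇒0≤j-i-1 p<q)) (0≤-+ (ℤₚ.i≤j⇒0≤j-i wq≤p) (i<j⇒0≤j-i-1 p<q)))
    (begin
    ((wp - q) + (q - p - 1ℤ)) + ((p - wq) + (q - p - 1ℤ))  ≡⟨ eq₁ p q wp wq ⟩
    (wp - p) - (wq - q) - + 2                              ≡⟨ cong (λ d → d - (wq - q) - + 2) same-step ⟩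
    (wq - q) - (wq - q) - + 2                              ≡⟨ eq₂ (wq - q) ⟩
    -[1+ 1 ]                                               ∎)
  where
  open ≡-Reasoning
  eq₁ : ∀ p q wp wq → ((wp - q) + (q - p - 1ℤ)) + ((p - wq) + (q - p - 1ℤ)) ≡ (wp - p) - (wq - q) - + 2
  eq₁ = solve-∀
  eq₂ : ∀ d → d - d - + 2 ≡ -[1+ 1 ]
  eq₂ = solve-∀
  same-step : wp - p ≡ wq - q
  same-step = signed-injective s (begin
    signed s (wp - p)                       ≡⟨ signed-difference s o₁ wp p ⟨
    (signed s wp + o₁) - (signed s p + o₁)  ≡⟨ cong₂ _-_ at-wp at-p ⟩
    (signed s wq + o₂) - (signed s q + o₂)  ≡⟨ signed-difference s o₂ wq q ⟩
    signed s (wq - q)                       ∎)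

-- If p < q ≤ w p and w q ≤ p, a symmetry identifying p with q and w p with w q
-- must reverse orientation, and then it also identifies q with p.
affine-swap : ∀ s₁ s₂ o₁ o₂ {p q wp wq} → p < q → q ≤ wp → wq ≤ p →
              signed s₁ p + o₁ ≡ signed s₂ q + o₂ → signed s₁ wp + o₁ ≡ signed s₂ wq + o₂ →
              signed s₁ q + o₁ ≡ signed s₂ p + o₂
affine-swap false true o₁ o₂ {p} {q} _ _ _ at-p _ = begin
  q + o₁                ≡⟨ eq₁ p q o₁ ⟩
  (p + o₁) + (q - p)    ≡⟨ cong (λ u → u + (q - p)) at-p ⟩
  (- q + o₂) + (q - p)  ≡⟨ eq₂ p q o₂ ⟩
  - p + o₂              ∎
  where
  open ≡-Reasoning
  eq₁ : ∀ p q o → q + o ≡ (p + o) + (q - p)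
  eq₁ = solve-∀
  eq₂ : ∀ p q o → (- q + o) + (q - p) ≡ - p + o
  eq₂ = solve-∀
affine-swap true false o₁ o₂ {p} {q} _ _ _ at-p _ = begin
  - q + o₁              ≡⟨ eq₁ p q o₁ ⟩
  (- p + o₁) + (p - q)  ≡⟨ cong (λ u → u + (p - q)) at-p ⟩
  (q + o₂) + (p - q)    ≡⟨ eq₂ p q o₂ ⟩
  p + o₂                ∎
  where
  open ≡-Reasoning
  eq₁ : ∀ p q o → - q + o ≡ (- p + o) + (p - q)
  eq₁ = solve-∀
  eq₂ : ∀ p q o → (q + o) + (p - q) ≡ p + o
  eq₂ = solve-∀
affine-swap false false o₁ o₂ p<q q≤wp wq≤p at-p at-wp =
  ⊥-elim (same-orientation-impossible false o₁ o₂ p<q q≤wp wq≤p at-p at-wp)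
affine-swap true true o₁ o₂ p<q q≤wp wq≤p at-p at-wp =
  ⊥-elim (same-orientation-impossible true o₁ o₂ p<q q≤wp wq≤p at-p at-wp)

-- Admissible maps

-- Membership in W without the window-sum condition of S̃_n, with the defining
-- symmetries stated as equivariance under the whole group they generate.
record Admissible (T : GeorgeType) (n : ℕ) (σ : ℤ → ℤ) : Set where
  field
    inv : ℤ → ℤ
    inv-left : ∀ x → inv (σ x) ≡ x
    inv-right : ∀ x → σ (inv x) ≡ x
    equivariant : ∀ g x → σ (act T n g x) ≡ act T n g (σ x)
    fixOutside : ∀ x → ¬ Domain T n x → σ x ≡ x

  injective : ∀ {x y} → σ x ≡ σ y → x ≡ y
  injective {x} {y} σx≡σy = trans (sym (inv-left x)) (trans (cong inv σx≡σy) (inv-left y))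

Involutive : (ℤ → ℤ) → Set
Involutive t = ∀ x → t (t x) ≡ x

-- The symmetry group acts by affine isometries x ↦ ± x + c, and every orbit has a
-- distinguished representative, which lies in the window [n] unless every admissible
-- map fixes it.
record Symmetries (T : GeorgeType) (n : ℕ) : Set₁ where
  field
    identity : SymGroup T
    act-identity : ∀ x → act T n identity x ≡ x
    _·_ : SymGroup T → SymGroup T → SymGroup T
    act-· : ∀ g h x → act T n (g · h) x ≡ act T n g (act T n h x)
    inverse : SymGroup T → SymGroup T
    act-inverse : ∀ g x → act T n (inverse g) (act T n g x) ≡ x
    sign : SymGroup T → Bool
    offset : SymGroup T → ℤ
    act-affine : ∀ g x → act T n g x ≡ signed (sign g) x + offset g
    orbit? : ∀ x a → (Σ (SymGroup T) λ g → x ≡ act T n g a) ⊎ (∀ g → x ≢ act T n g a)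
    domain? : Decidable (Domain T n)
    act-domain : ∀ g {x} → Domain T n x → Domain T n (act T n g x)
    reduce : ℤ → SymGroup T
    rep-invariant : ∀ g x → act T n (reduce (act T n g x)) (act T n g x) ≡ act T n (reduce x) x
    rep-window : ∀ i → Window n i → act T n (reduce i) i ≡ i
    rep-in-window-or-fixed : ∀ {σ} → Admissible T n σ → ∀ x →
      Window n (act T n (reduce x) x) ⊎ σ (act T n (reduce x) x) ≡ act T n (reduce x) x

module AdmissibleMaps {T : GeorgeType} {n : ℕ} (S : Symmetries T n) where

  open Symmetries S

  infixr 9 _⊙_
  _⊙_ : SymGroup T → ℤ → ℤ
  g ⊙ x = act T n g x

  rep : ℤ → ℤ
  rep x = reduce x ⊙ x

  Invariant : ∀ {c} {C : Set c} → (ℤ → C) → Set c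
  Invariant φ = ∀ g x → φ (g ⊙ x) ≡ φ x

  ⊙-injective : ∀ g {x y} → g ⊙ x ≡ g ⊙ y → x ≡ y
  ⊙-injective g {x} {y} gx≡gy = trans (sym (act-inverse g x)) (trans (cong (inverse g ⊙_) gx≡gy) (act-inverse g y))

  ⊙-isometry : ∀ g x y → ∣ g ⊙ x - g ⊙ y ∣ ≡ ∣ x - y ∣
  ⊙-isometry g x y = begin
    ∣ g ⊙ x - g ⊙ y ∣
      ≡⟨ cong₂ (λ u v → ∣ u - v ∣) (act-affine g x) (act-affine g y) ⟩
    ∣ (signed (sign g) x + offset g) - (signed (sign g) y + offset g) ∣
      ≡⟨ cong ∣_∣ (signed-difference (sign g) (offset g) x y) ⟩
    ∣ signed (sign g) (x - y) ∣
      ≡⟨ ∣signed∣ (sign g) (x - y) ⟩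
    ∣ x - y ∣ ∎
    where
    open ≡-Reasoning
    ∣signed∣ : ∀ s z → ∣ signed s z ∣ ≡ ∣ z ∣
    ∣signed∣ false z = refl
    ∣signed∣ true z = ℤₚ.∣-i∣≡∣i∣ z

  ⊙-rigid : ∀ g g′ {x y} → x ≢ y → g ⊙ x ≡ g′ ⊙ x → g ⊙ y ≡ g′ ⊙ y → ∀ z → g ⊙ z ≡ g′ ⊙ z
  ⊙-rigid g g′ x≢y at-x at-y z = trans (act-affine g z) (trans
    (affine-rigid (sign g) (sign g′) (offset g) (offset g′) x≢y (affine at-x) (affine at-y) z) (sym (act-affine g′ z)))
    where
    affine : ∀ {x} → g ⊙ x ≡ g′ ⊙ x → signed (sign g) x + offset g ≡ signed (sign g′) x + offset g′
    affine {x} eq = trans (sym (act-affine g x)) (trans eq (act-affine g′ x))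

  ⊙-swap : ∀ g₁ g₂ {p q wp wq} → p < q → q ≤ wp → wq ≤ p →
           g₁ ⊙ p ≡ g₂ ⊙ q → g₁ ⊙ wp ≡ g₂ ⊙ wq → g₁ ⊙ q ≡ g₂ ⊙ p
  ⊙-swap g₁ g₂ {p} {q} {wp} {wq} p<q q≤wp wq≤p at-p at-wp = trans (act-affine g₁ q) (trans
    (affine-swap (sign g₁) (sign g₂) (offset g₁) (offset g₂) p<q q≤wp wq≤p (affine at-p) (affine at-wp)) (sym (act-affine g₂ p)))
    where
    affine : ∀ {x y} → g₁ ⊙ x ≡ g₂ ⊙ y → signed (sign g₁) x + offset g₁ ≡ signed (sign g₂) y + offset g₂
    affine {x} {y} eq = trans (sym (act-affine g₁ x)) (trans eq (act-affine g₂ y))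

  ⊙-outside-orbit : ∀ {a} h {x} → (∀ g → x ≢ g ⊙ a) → ∀ g → h ⊙ x ≢ g ⊙ a
  ⊙-outside-orbit {a} h {x} x∉orbit g hx≡ga = x∉orbit (inverse h · g) (begin
    x                    ≡⟨ act-inverse h x ⟨
    inverse h ⊙ h ⊙ x    ≡⟨ cong (inverse h ⊙_) hx≡ga ⟩
    inverse h ⊙ g ⊙ a    ≡⟨ act-· (inverse h) g a ⟨
    (inverse h · g) ⊙ a  ∎)
    where open ≡-Reasoning

  admissible-∘ : ∀ {σ τ} → Admissible T n σ → Admissible T n τ → Admissible T n (σ ∘ τ)
  admissible-∘ {σ} {τ} Aσ Aτ = record
    { inv = Aτ.inv ∘ Aσ.inv
    ; inv-left = λ x → trans (cong Aτ.inv (Aσ.inv-left (τ x))) (Aτ.inv-left x)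
    ; inv-right = λ x → trans (cong σ (Aτ.inv-right _)) (Aσ.inv-right x)
    ; equivariant = λ g x → trans (cong σ (Aτ.equivariant g x)) (Aσ.equivariant g (τ x))
    ; fixOutside = λ x x∉D → trans (cong σ (Aτ.fixOutside x x∉D)) (Aσ.fixOutside x x∉D) }
    where
    module Aσ = Admissible Aσ
    module Aτ = Admissible Aτ

  admissible-inverse : ∀ {σ} (Aσ : Admissible T n σ) → Admissible T n (Admissible.inv Aσ)
  admissible-inverse {σ} Aσ = record
    { inv = σ
    ; inv-left = inv-right
    ; inv-right = inv-left
    ; equivariant = λ g x → injective (trans (inv-right (g ⊙ x)) (sym (trans (equivariant g (inv x)) (cong (g ⊙_) (inv-right x)))))
    ; fixOutside = λ x x∉D → injective (trans (inv-right x) (sym (fixOutside x x∉D))) }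
    where open Admissible Aσ

  moved⇒domain : ∀ {σ} → Admissible T n σ → ∀ {x} → σ x ≢ x → Domain T n x
  moved⇒domain Aσ {x} σx≢x with domain? x
  ... | yes x∈D = x∈D
  ... | no x∉D = ⊥-elim (σx≢x (Admissible.fixOutside Aσ x x∉D))

  admissible-domain : ∀ {σ} → Admissible T n σ → ∀ {x} → Domain T n x → Domain T n (σ x)
  admissible-domain {σ} Aσ {x} x∈D with domain? (σ x)
  ... | yes σx∈D = σx∈D
  ... | no σx∉D = subst (Domain T n) (sym (Admissible.injective Aσ (Admissible.fixOutside Aσ (σ x) σx∉D))) x∈D

  rep-of-orbit : ∀ x → x ≡ inverse (reduce x) ⊙ rep x
  rep-of-orbit x = sym (act-inverse (reduce x) x)

  -- An admissible map fixing the window fixes every representative, hence everything.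
  admissible-window-fixed : ∀ {σ} → Admissible T n σ → (∀ i → Window n i → σ i ≡ i) → ∀ x → σ x ≡ x
  admissible-window-fixed {σ} Aσ σ-fixes-window x = begin
    σ x                              ≡⟨ cong σ (rep-of-orbit x) ⟩
    σ (inverse (reduce x) ⊙ rep x)   ≡⟨ Admissible.equivariant Aσ _ (rep x) ⟩
    inverse (reduce x) ⊙ σ (rep x)   ≡⟨ cong (inverse (reduce x) ⊙_) rep-fixed ⟩
    inverse (reduce x) ⊙ rep x       ≡⟨ rep-of-orbit x ⟨
    x                                ∎
    where
    open ≡-Reasoning
    rep-fixed : σ (rep x) ≡ rep x
    rep-fixed with rep-in-window-or-fixed Aσ x
    ... | inj₁ in-window = σ-fixes-window (rep x) in-window
    ... | inj₂ fixed = fixed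

  rep-image-in-window : ∀ {σ} → Admissible T n σ → ∀ i → Window n i → Window n (rep (σ i))
  rep-image-in-window {σ} Aσ i i∈W with rep-in-window-or-fixed Aσ (σ i)
  ... | inj₁ in-window = in-window
  ... | inj₂ fixed = subst (Window n) (sym (trans (cong rep σi≡i) (rep-window i i∈W))) i∈W
    where
    σi≡i : σ i ≡ i
    σi≡i = Admissible.injective Aσ (⊙-injective (reduce (σ i)) (trans (sym (Admissible.equivariant Aσ _ (σ i))) fixed))

  displacement-invariant : ∀ {σ} → Admissible T n σ → Invariant (displacement σ)
  displacement-invariant {σ} Aσ g x =
    trans (cong (λ y → ∣ y - g ⊙ x ∣) (Admissible.equivariant Aσ g x)) (⊙-isometry g (σ x) x)

  displacement≤tvd : ∀ {σ} → Admissible T n σ → ∀ x → displacement σ x ℕ.≤ tvd n σ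
  displacement≤tvd {σ} Aσ x with rep-in-window-or-fixed Aσ x
  ... | inj₁ in-window with window-pos (rep x) in-window
  ...   | j , rep≡ , j<n = subst₂ ℕ._≤_ at-rep (sym (tvd≡Σℕ n σ)) (Σℕ-term n (λ k → displacement σ (+ suc k)) j<n)
    where
    at-rep : displacement σ (+ suc j) ≡ displacement σ x
    at-rep = trans (cong (displacement σ) (sym rep≡)) (displacement-invariant Aσ (reduce x) x)
  displacement≤tvd {σ} Aσ x | inj₂ fixed =
    subst (ℕ._≤ tvd n σ) (trans (cong (λ y → ∣ y - rep x ∣) (sym fixed)) (displacement-invariant Aσ (reduce x) x))
      (subst (ℕ._≤ tvd n σ) (sym (cong ∣_∣ (ℤₚ.+-inverseʳ (rep x)))) ℕ.z≤n)

  rep-inverse-rep : ∀ {σ} (Aσ : Admissible T n σ) i → Window n i → rep (Admissible.inv Aσ (rep (σ i))) ≡ i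
  rep-inverse-rep {σ} Aσ i i∈W = begin
    rep (inv (h ⊙ σ i))   ≡⟨ cong rep (Admissible.equivariant (admissible-inverse Aσ) h (σ i)) ⟩
    rep (h ⊙ inv (σ i))   ≡⟨ cong (λ y → rep (h ⊙ y)) (inv-left i) ⟩
    rep (h ⊙ i)           ≡⟨ rep-invariant h i ⟩
    rep i                 ≡⟨ rep-window i i∈W ⟩
    i                     ∎
    where
    open ≡-Reasoning
    open Admissible Aσ
    h = reduce (σ i)

  module InvariantSums {a ℓ} (M : CommutativeMonoid a ℓ) where

    open CommutativeMonoid M using (_≈_; reflexive) renaming (Carrier to C; trans to ≈-trans)
    open MonoidSums M using (Σ<; Σ<-cong; Σ<-permute-window)

    -- Composing with rep turns an admissible map into a permutation of the window.
    Σ<-admissible : ∀ {σ} → Admissible T n σ → (φ : ℤ → C) → Invariant φ →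
                    Σ< n (λ k → φ (+ suc k)) ≈ Σ< n (λ k → φ (σ (+ suc k)))
    Σ<-admissible {σ} Aσ φ φ-invariant = ≈-trans
      (Σ<-permute-window (rep ∘ σ) (rep ∘ Admissible.inv Aσ)
        (rep-image-in-window Aσ) (rep-image-in-window (admissible-inverse Aσ))
        (rep-inverse-rep Aσ) (rep-inverse-rep (admissible-inverse Aσ)) φ)
      (reflexive (Σ<-cong n (λ k _ → φ-invariant (reduce (σ (+ suc k))) (σ (+ suc k)))))

  open InvariantSums ℕₚ.+-0-commutativeMonoid using () renaming (Σ<-admissible to Σℕ-admissible)

  tvd-∘ : ∀ {t u} → Admissible T n t → Admissible T n u → tvd n (t ∘ u) ℕ.≤ tvd n t ℕ.+ tvd n u
  tvd-∘ {t} {u} At Au = begin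
    tvd n (t ∘ u)
      ≡⟨ tvd≡Σℕ n (t ∘ u) ⟩
    Σℕ n (λ k → displacement (t ∘ u) (+ suc k))
      ≤⟨ Σℕ-mono n (λ k → ∣a-c∣≤∣a-b∣+∣b-c∣ (t (u (+ suc k))) (u (+ suc k)) (+ suc k)) ⟩
    Σℕ n (λ k → displacement t (u (+ suc k)) ℕ.+ displacement u (+ suc k))
      ≡⟨ Σℕ-distrib n _ _ ⟩
    Σℕ n (λ k → displacement t (u (+ suc k))) ℕ.+ Σℕ n (λ k → displacement u (+ suc k))
      ≡⟨ cong₂ ℕ._+_ (sym (Σℕ-admissible Au (displacement t) (displacement-invariant At))) (sym (tvd≡Σℕ n u)) ⟩
    Σℕ n (λ k → displacement t (+ suc k)) ℕ.+ tvd n u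
      ≡⟨ cong (ℕ._+ tvd n u) (tvd≡Σℕ n t) ⟨
    tvd n t ℕ.+ tvd n u ∎
    where open ℕₚ.≤-Reasoning

  tvd-cong : ∀ {f g} → (∀ x → f x ≡ g x) → tvd n f ≡ tvd n g
  tvd-cong {f} {g} f≗g = trans (tvd≡Σℕ n f) (trans
    (Σℕ-cong n (λ k _ → cong (λ y → ∣ y - + suc k ∣) (f≗g (+ suc k)))) (sym (tvd≡Σℕ n g)))

  tvd-id : tvd n (λ x → x) ≡ 0
  tvd-id = trans (tvd≡Σℕ n (λ x → x)) (Σℕ-zero n (λ k → cong ∣_∣ (ℤₚ.+-inverseʳ (+ suc k))))

  data OrbitClass (i j x : ℤ) : Set where
    orbit-of-i : ∀ g → x ≡ g ⊙ i → OrbitClass i j x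
    orbit-of-j : ∀ g → x ≡ g ⊙ j → OrbitClass i j x
    other : (∀ g → (x ≢ g ⊙ i) × (x ≢ g ⊙ j)) → OrbitClass i j x

  classify : ∀ i j x → OrbitClass i j x
  classify i j x with orbit? x i
  ... | inj₁ (g , x≡gi) = orbit-of-i g x≡gi
  ... | inj₂ x∉Gi with orbit? x j
  ...   | inj₁ (g , x≡gj) = orbit-of-j g x≡gj
  ...   | inj₂ x∉Gj = other (λ g → x∉Gi g , x∉Gj g)

  module _ {i j t} (Di : Domain T n i) (Dj : Domain T n j) (spec : IsTranspositionOf T n i j t) where

    private
      swaps : ∀ g → (t (g ⊙ i) ≡ g ⊙ j) × (t (g ⊙ j) ≡ g ⊙ i)
      swaps = proj₁ spec
      fixes : ∀ x → (∀ g → (x ≢ g ⊙ i) × (x ≢ g ⊙ j)) → t x ≡ x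
      fixes = proj₂ spec

    transposition-involutive : Involutive t
    transposition-involutive x with classify i j x
    ... | orbit-of-i g refl = trans (cong t (proj₁ (swaps g))) (proj₂ (swaps g))
    ... | orbit-of-j g refl = trans (cong t (proj₂ (swaps g))) (proj₁ (swaps g))
    ... | other x∉ = trans (cong t (fixes x x∉)) (fixes x x∉)

    transposition-equivariant : ∀ h x → t (h ⊙ x) ≡ h ⊙ t x
    transposition-equivariant h x with classify i j x
    ... | orbit-of-i g refl = begin
      t (h ⊙ g ⊙ i)    ≡⟨ cong t (act-· h g i) ⟨
      t ((h · g) ⊙ i)  ≡⟨ proj₁ (swaps (h · g)) ⟩
      (h · g) ⊙ j      ≡⟨ act-· h g j ⟩
      h ⊙ g ⊙ j        ≡⟨ cong (h ⊙_) (proj₁ (swaps g)) ⟨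
      h ⊙ t (g ⊙ i)    ∎
      where open ≡-Reasoning
    ... | orbit-of-j g refl = begin
      t (h ⊙ g ⊙ j)    ≡⟨ cong t (act-· h g j) ⟨
      t ((h · g) ⊙ j)  ≡⟨ proj₂ (swaps (h · g)) ⟩
      (h · g) ⊙ i      ≡⟨ act-· h g i ⟩
      h ⊙ g ⊙ i        ≡⟨ cong (h ⊙_) (proj₂ (swaps g)) ⟨
      h ⊙ t (g ⊙ j)    ∎
      where open ≡-Reasoning
    ... | other x∉ = trans
      (fixes (h ⊙ x) (λ g → ⊙-outside-orbit h (proj₁ ∘ x∉) g , ⊙-outside-orbit h (proj₂ ∘ x∉) g))
      (cong (h ⊙_) (sym (fixes x x∉)))

    transposition-admissible : Admissible T n t
    transposition-admissible = record
      { inv = t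
      ; inv-left = transposition-involutive
      ; inv-right = transposition-involutive
      ; equivariant = transposition-equivariant
      ; fixOutside = λ x x∉D → fixes x (λ g → (λ x≡gi → x∉D (subst (Domain T n) (sym x≡gi) (act-domain g Di)))
                                              , (λ x≡gj → x∉D (subst (Domain T n) (sym x≡gj) (act-domain g Dj)))) }

  admissible-transposition : (t : Transposition T n) → Admissible T n (proj₁ t)
  admissible-transposition (_ , _ , _ , (_ , Di , Dj , _) , spec) = transposition-admissible Di Dj spec

  admissible-id : Admissible T n (λ x → x)
  admissible-id = record { inv = λ x → x ; inv-left = λ _ → refl ; inv-right = λ _ → refl
                         ; equivariant = λ _ _ → refl ; fixOutside = λ _ _ → refl }

  admissible-product : ∀ (ts : List (Transposition T n)) → Admissible T n (product ts)
  admissible-product [] = admissible-id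
  admissible-product (t ∷ ts) = admissible-∘ (admissible-transposition t) (admissible-product ts)

  tvd-product≤ : ∀ (ts : List (Transposition T n)) → tvd n (product ts) ℕ.≤ doubledCostSum ts
  tvd-product≤ [] = ℕₚ.≤-reflexive tvd-id
  tvd-product≤ (t ∷ ts) = ℕₚ.≤-trans (tvd-∘ (admissible-transposition t) (admissible-product ts))
                                      (ℕₚ.+-monoʳ-≤ (tvd n (proj₁ t)) (tvd-product≤ ts))

  cost-lower-bound : ∀ {w} (ts : List (Transposition T n)) → IsFactorization T n w ts → tvd n w ℕ.≤ doubledCostSum ts
  cost-lower-bound ts factorization = subst (ℕ._≤ doubledCostSum ts) (tvd-cong factorization) (tvd-product≤ ts)

-- Cost equals displacement

module CrossingTransposition {T n} (S : Symmetries T n) {w} (Aw : Admissible T n w)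
                             {p q} (p<q : p < q) (wq≤p : w q ≤ p) (q≤wp : q ≤ w p) where

  open Symmetries S
  open AdmissibleMaps S
  open InvariantSums ℕₚ.+-0-commutativeMonoid using () renaming (Σ<-admissible to Σℕ-admissible)

  private
    p≢wp : p ≢ w p
    p≢wp p≡wp = ℤₚ.<⇒≱ p<q (subst (q ≤_) (sym p≡wp) q≤wp)

    q≢wq : q ≢ w q
    q≢wq q≡wq = ℤₚ.<⇒≱ p<q (subst (_≤ p) (sym q≡wq) wq≤p)

    w-respects : ∀ g g′ {x y} → g ⊙ x ≡ g′ ⊙ y → g ⊙ w x ≡ g′ ⊙ w y
    w-respects g g′ {x} {y} gx≡g′y =
      trans (sym (Admissible.equivariant Aw g x)) (trans (cong w gx≡g′y) (Admissible.equivariant Aw g′ y))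

    p≡q⇒q≡p : ∀ g₁ g₂ → g₁ ⊙ p ≡ g₂ ⊙ q → g₁ ⊙ q ≡ g₂ ⊙ p
    p≡q⇒q≡p g₁ g₂ g₁p≡g₂q = ⊙-swap g₁ g₂ p<q q≤wp wq≤p g₁p≡g₂q (w-respects g₁ g₂ g₁p≡g₂q)

  swapped : ∀ x → OrbitClass p q x → ℤ
  swapped x (orbit-of-i g _) = g ⊙ q
  swapped x (orbit-of-j g _) = g ⊙ p
  swapped x (other _) = x

  t : ℤ → ℤ
  t x = swapped x (classify p q x)

  t-orbit-p : ∀ g → t (g ⊙ p) ≡ g ⊙ q
  t-orbit-p g = on (classify p q (g ⊙ p))
    where
    on : (c : OrbitClass p q (g ⊙ p)) → swapped (g ⊙ p) c ≡ g ⊙ q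
    on (orbit-of-i g′ gp≡g′p) = ⊙-rigid g′ g p≢wp (sym gp≡g′p) (w-respects g′ g (sym gp≡g′p)) q
    on (orbit-of-j g′ gp≡g′q) = sym (p≡q⇒q≡p g g′ gp≡g′q)
    on (other outside) = ⊥-elim (proj₁ (outside g) refl)

  t-orbit-q : ∀ g → t (g ⊙ q) ≡ g ⊙ p
  t-orbit-q g = on (classify p q (g ⊙ q))
    where
    on : (c : OrbitClass p q (g ⊙ q)) → swapped (g ⊙ q) c ≡ g ⊙ p
    on (orbit-of-i g′ gq≡g′p) = p≡q⇒q≡p g′ g (sym gq≡g′p)
    on (orbit-of-j g′ gq≡g′q) = ⊙-rigid g′ g q≢wq (sym gq≡g′q) (w-respects g′ g (sym gq≡g′q)) p
    on (other outside) = ⊥-elim (proj₂ (outside g) refl)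

  t-spec : IsTranspositionOf T n p q t
  t-spec = (λ g → t-orbit-p g , t-orbit-q g) , fixed
    where
    fixed : ∀ x → (∀ g → (x ≢ g ⊙ p) × (x ≢ g ⊙ q)) → t x ≡ x
    fixed x outside with classify p q x
    ... | orbit-of-i g x≡gp = ⊥-elim (proj₁ (outside g) x≡gp)
    ... | orbit-of-j g x≡gq = ⊥-elim (proj₂ (outside g) x≡gq)
    ... | other _ = refl

  p∈D : Domain T n p
  p∈D = moved⇒domain Aw (p≢wp ∘ sym)

  q∈D : Domain T n q
  q∈D = moved⇒domain Aw (q≢wq ∘ sym)

  At : Admissible T n t
  At = transposition-admissible p∈D q∈D t-spec

  t-involutive : Involutive t
  t-involutive = transposition-involutive p∈D q∈D t-spec

  t-p : t p ≡ q
  t-p = trans (cong t (sym (act-identity p))) (trans (t-orbit-p identity) (act-identity q))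

  t-q : t q ≡ p
  t-q = trans (cong t (sym (act-identity q))) (trans (t-orbit-q identity) (act-identity p))

  -- q lies between p and w p, and p between w q and q: on these orbits w moves a
  -- point monotonically through its image under t.
  displacement-splits : ∀ x → displacement w x ≡ ∣ w x - t x ∣ ℕ.+ displacement t x
  displacement-splits x = split (classify p q x)
    where
    via : ∀ g {a b y} → y ≡ g ⊙ a → ∣ w a - a ∣ ≡ ∣ w a - b ∣ ℕ.+ ∣ b - a ∣ →
          displacement w y ≡ ∣ w y - g ⊙ b ∣ ℕ.+ ∣ g ⊙ b - y ∣
    via g {a} {b} refl between = begin
      ∣ w (g ⊙ a) - g ⊙ a ∣                        ≡⟨ cong (λ v → ∣ v - g ⊙ a ∣) (equivariant g a) ⟩
      ∣ g ⊙ w a - g ⊙ a ∣                          ≡⟨ ⊙-isometry g (w a) a ⟩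
      ∣ w a - a ∣                                  ≡⟨ between ⟩
      ∣ w a - b ∣ ℕ.+ ∣ b - a ∣                    ≡⟨ cong₂ ℕ._+_ (⊙-isometry g (w a) b) (⊙-isometry g b a) ⟨
      ∣ g ⊙ w a - g ⊙ b ∣ ℕ.+ ∣ g ⊙ b - g ⊙ a ∣    ≡⟨ cong (λ v → ∣ v - g ⊙ b ∣ ℕ.+ _) (equivariant g a) ⟨
      ∣ w (g ⊙ a) - g ⊙ b ∣ ℕ.+ ∣ g ⊙ b - g ⊙ a ∣  ∎
      where
      open ≡-Reasoning
      open Admissible Aw using (equivariant)
    split : (c : OrbitClass p q x) → displacement w x ≡ ∣ w x - swapped x c ∣ ℕ.+ ∣ swapped x c - x ∣
    split (orbit-of-i g x≡gp) = via g x≡gp (∣c-a∣≡∣c-b∣+∣b-a∣ (ℤₚ.<⇒≤ p<q) q≤wp)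
    split (orbit-of-j g x≡gq) = via g x≡gq (∣c-a∣≡∣c-b∣+∣b-a∣′ wq≤p (ℤₚ.<⇒≤ p<q))
    split (other _) = trans (sym (ℕₚ.+-identityʳ _)) (cong (displacement w x ℕ.+_) (sym (cong ∣_∣ (ℤₚ.+-inverseʳ x))))

  tvd-splits : tvd n (w ∘ t) ℕ.+ tvd n t ≡ tvd n w
  tvd-splits = begin
    tvd n (w ∘ t) ℕ.+ tvd n t
      ≡⟨ cong₂ ℕ._+_ (tvd≡Σℕ n (w ∘ t)) (tvd≡Σℕ n t) ⟩
    Σℕ n (λ k → displacement (w ∘ t) (+ suc k)) ℕ.+ Σℕ n (λ k → displacement t (+ suc k))
      ≡⟨ cong (ℕ._+ Σℕ n (λ k → displacement t (+ suc k))) reindexed ⟨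
    Σℕ n (λ k → ∣ w (+ suc k) - t (+ suc k) ∣) ℕ.+ Σℕ n (λ k → displacement t (+ suc k))
      ≡⟨ Σℕ-distrib n _ _ ⟨
    Σℕ n (λ k → ∣ w (+ suc k) - t (+ suc k) ∣ ℕ.+ displacement t (+ suc k))
      ≡⟨ Σℕ-cong n (λ k _ → displacement-splits (+ suc k)) ⟨
    Σℕ n (λ k → displacement w (+ suc k))
      ≡⟨ tvd≡Σℕ n w ⟨
    tvd n w ∎
    where
    open ≡-Reasoning
    gap-invariant : Invariant (λ x → ∣ w x - t x ∣)
    gap-invariant g x = trans (cong₂ (λ u v → ∣ u - v ∣) (Admissible.equivariant Aw g x) (Admissible.equivariant At g x))
                              (⊙-isometry g (w x) (t x))
    reindexed : Σℕ n (λ k → ∣ w (+ suc k) - t (+ suc k) ∣) ≡ Σℕ n (λ k → displacement (w ∘ t) (+ suc k))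
    reindexed = trans (Σℕ-admissible At _ gap-invariant)
                      (Σℕ-cong n (λ k _ → cong (λ v → ∣ w (t (+ suc k)) - v ∣) (t-involutive (+ suc k))))

  tvd-t-positive : 1 ℕ.≤ tvd n t
  tvd-t-positive = ℕₚ.≤-trans 1≤∣q-p∣ (subst (ℕ._≤ tvd n t) (cong (λ v → ∣ v - p ∣) t-p) (displacement≤tvd At p))
    where
    1≤∣q-p∣ : 1 ℕ.≤ ∣ q - p ∣
    1≤∣q-p∣ = ℤₚ.drop‿+≤+ (subst (1ℤ ≤_) (sym (ℤₚ.0≤i⇒+∣i∣≡i (ℤₚ.i≤j⇒0≤j-i (ℤₚ.<⇒≤ p<q))))
                                (≤-by (i<j⇒0≤j-i-1 p<q) refl))

-- W consists of the admissible maps satisfying SideCondition, which is trivial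
-- except for S̃_n, where it is the condition on the window sum.
record Membership {T n} (S : Symmetries T n) : Set₁ where
  field
    SideCondition : (ℤ → ℤ) → Set
    fromInW : ∀ {w} → InW T n w → Admissible T n w × SideCondition w
    toInW : ∀ {w} → Admissible T n w → SideCondition w → InW T n w
    side-involution : ∀ {t} → Admissible T n t → Involutive t → SideCondition t
    side-∘-involution : ∀ {w t} → Admissible T n w → SideCondition w → Admissible T n t → Involutive t →
                        SideCondition (w ∘ t)
    rising-balanced : ∀ {σ} → Admissible T n σ → SideCondition σ → ∀ {p} → p < σ p → NonRisingSegmentFrom σ p
    falling-balanced : ∀ {σ} → Admissible T n σ → SideCondition σ → ∀ {q} → σ q < q → NonFallingSegmentTo σ q

product-++ : ∀ {T n} (xs ys : List (Transposition T n)) x → product (xs ++ ys) x ≡ product xs (product ys x)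
product-++ [] ys x = refl
product-++ ((t , _) ∷ xs) ys x = cong t (product-++ xs ys x)

doubledCostSum-++ : ∀ {T n} (xs ys : List (Transposition T n)) →
                    doubledCostSum (xs ++ ys) ≡ doubledCostSum xs ℕ.+ doubledCostSum ys
doubledCostSum-++ [] ys = refl
doubledCostSum-++ {n = n} ((t , _) ∷ xs) ys =
  trans (cong (tvd n t ℕ.+_) (doubledCostSum-++ xs ys)) (sym (ℕₚ.+-assoc (tvd n t) _ _))

module CostEqualsDisplacement {T n} {S : Symmetries T n} (M : Membership S) where

  open AdmissibleMaps S
  open Membership M

  window-fixed-or-moved : ∀ (σ : ℤ → ℤ) → (∀ i → Window n i → σ i ≡ i) ⊎ Σ ℤ λ y → σ y ≢ y
  window-fixed-or-moved σ with ℕₚ.anyUpTo? (λ j → ¬? (σ (+ suc j) ℤₚ.≟ + suc j)) n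
  ... | yes (j , _ , moved) = inj₂ (+ suc j , moved)
  ... | no none = inj₁ fixed
    where
    fixed : ∀ i → Window n i → σ i ≡ i
    fixed i i∈W with window-pos i i∈W
    ... | j , refl , j<n = decidable-stable (σ (+ suc j) ℤₚ.≟ + suc j) (λ moved → none (j , j<n , moved))

  OptimalFactorization : (ℤ → ℤ) → Set
  OptimalFactorization w = Σ (List (Transposition T n)) λ ts → IsFactorization T n w ts × (doubledCostSum ts ≡ tvd n w)

  -- Split off the transposition of a crossing; the displacement drops by exactly its cost.
  optimal-factorization : ∀ fuel {w} → Admissible T n w → SideCondition w → tvd n w ℕ.≤ fuel → OptimalFactorization w
  optimal-factorization fuel {w} Aw Sw tvd≤fuel with window-fixed-or-moved w
  ... | inj₁ fixed =
    [] , (λ x → sym (admissible-window-fixed Aw fixed x)) , sym (trans (tvd-cong (admissible-window-fixed Aw fixed)) tvd-id)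
  ... | inj₂ (y , moved) with Crossings.crossing w (Admissible.injective Aw) (tvd n w) (displacement≤tvd Aw)
                                (rising-balanced Aw Sw) (falling-balanced Aw Sw) y moved
  ...   | p , q , p<q , wq≤p , q≤wp = step fuel tvd≤fuel
    where
    open CrossingTransposition S Aw p<q wq≤p q≤wp
    transposition : Transposition T n
    transposition = t , p , q , (ℤₚ.<⇒≢ p<q , p∈D , q∈D , t , toInW At (side-involution At t-involutive) , t-p , t-q) , t-spec
    smaller : suc (tvd n (w ∘ t)) ℕ.≤ tvd n w
    smaller = subst (suc (tvd n (w ∘ t)) ℕ.≤_) tvd-splits
      (subst (ℕ._≤ tvd n (w ∘ t) ℕ.+ tvd n t) (ℕₚ.+-comm (tvd n (w ∘ t)) 1)
        (ℕₚ.+-monoʳ-≤ (tvd n (w ∘ t)) tvd-t-positive))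
    step : ∀ fuel → tvd n w ℕ.≤ fuel → OptimalFactorization w
    step zero tvd≤0 = ⊥-elim (ℕₚ.<⇒≱ (ℕₚ.≤-trans smaller tvd≤0) ℕ.z≤n)
    step (suc fuel) tvd≤fuel with optimal-factorization fuel (admissible-∘ Aw At)
                                    (side-∘-involution Aw Sw At t-involutive) (ℕₚ.≤-pred (ℕₚ.≤-trans smaller tvd≤fuel))
    ... | ts , factorization , cost = ts ++ transposition ∷ [] , factorization′ , cost′
      where
      factorization′ : IsFactorization T n w (ts ++ transposition ∷ [])
      factorization′ x = trans (product-++ ts (transposition ∷ []) x) (trans (factorization (t x)) (cong w (t-involutive x)))
      cost′ : doubledCostSum (ts ++ transposition ∷ []) ≡ tvd n w
      cost′ = trans (doubledCostSum-++ ts (transposition ∷ []))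
                    (trans (cong₂ ℕ._+_ cost (ℕₚ.+-identityʳ (tvd n t))) tvd-splits)

  doubledCost≡tvd : ∀ w → InW T n w → DoubledCost T n w (tvd n w)
  doubledCost≡tvd w w∈W =
    optimal-factorization (tvd n w) (proj₁ (fromInW w∈W)) (proj₂ (fromInW w∈W)) ℕₚ.≤-refl , cost-lower-bound

-- The four groups

-- For the finite groups every admissible map preserves a box [lo, hi] containing all
-- moved points, and segments running to the edge of the box are balanced.
boxedMembership : ∀ {T n} (S : Symmetries T n) (lo hi : ℤ) →
                  (∀ {w} → InW T n w → Admissible T n w) → (∀ {w} → Admissible T n w → InW T n w) →
                  (∀ {σ} → Admissible T n σ → ∀ x → lo ≤ x → x ≤ hi → (lo ≤ σ x) × (σ x ≤ hi)) →
                  (∀ {σ} → Admissible T n σ → ∀ {x} → σ x ≢ x → (lo ≤ x) × (x ≤ hi)) →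
                  Membership S
boxedMembership S lo hi admissible inW box moved-in-box = record
  { SideCondition = λ _ → ⊤
  ; fromInW = λ w∈W → admissible w∈W , tt
  ; toInW = λ Aw _ → inW Aw
  ; side-involution = λ _ _ → tt
  ; side-∘-involution = λ _ _ _ _ → tt
  ; rising-balanced = λ Aσ _ p<σp → let lo≤p , p≤hi = moved-in-box Aσ (λ σp≡p → ℤₚ.<⇒≢ p<σp (sym σp≡p)) in
      Crossings.box-rising _ (Admissible.injective Aσ) (box Aσ) lo≤p p≤hi
  ; falling-balanced = λ Aσ _ σq<q → let lo≤q , q≤hi = moved-in-box Aσ (ℤₚ.<⇒≢ σq<q) in
      Crossings.box-falling _ (Admissible.injective Aσ) (box Aσ) lo≤q q≤hi
  }

module TypeA (n : ℕ) where

  domain? : ∀ x → Dec (Domain typeA n x)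
  domain? x = (+ 1 ℤₚ.≤? x) ×-dec (x ℤₚ.≤? + n)

  symmetries : Symmetries typeA n
  symmetries = record
    { identity = tt ; act-identity = λ _ → refl
    ; _·_ = λ _ _ → tt ; act-· = λ _ _ _ → refl
    ; inverse = λ _ → tt ; act-inverse = λ _ _ → refl
    ; sign = λ _ → false ; offset = λ _ → 0ℤ ; act-affine = λ _ x → sym (ℤₚ.+-identityʳ x)
    ; orbit? = orbit? ; domain? = domain? ; act-domain = λ _ x∈D → x∈D
    ; reduce = λ _ → tt ; rep-invariant = λ _ _ → refl ; rep-window = λ _ _ → refl
    ; rep-in-window-or-fixed = in-window-or-fixed }
    where
    orbit? : ∀ x a → (Σ ⊤ λ _ → x ≡ a) ⊎ (⊤ → x ≢ a)
    orbit? x a with x ℤₚ.≟ a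
    ... | yes x≡a = inj₁ (tt , x≡a)
    ... | no x≢a = inj₂ (λ _ → x≢a)
    in-window-or-fixed : ∀ {σ} → Admissible typeA n σ → ∀ x → Window n x ⊎ σ x ≡ x
    in-window-or-fixed Aσ x with domain? x
    ... | yes x∈D = inj₁ x∈D
    ... | no x∉D = inj₂ (Admissible.fixOutside Aσ x x∉D)

  open AdmissibleMaps symmetries using (admissible-domain; moved⇒domain)

  membership : Membership symmetries
  membership = boxedMembership symmetries 1ℤ (+ n)
    (λ w∈W → record { InW w∈W ; equivariant = λ _ _ → refl })
    (λ Aw → record { Admissible Aw ; symmetric = tt })
    (λ Aσ x 1≤x x≤n → admissible-domain Aσ (1≤x , x≤n))
    moved⇒domain

module TypeB (n : ℕ) where

  domain? : ∀ x → Dec (Domain typeB n x)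
  domain? x = (1 ℕₚ.≤? ∣ x ∣) ×-dec (∣ x ∣ ℕₚ.≤? n)

  act-xor : ∀ g h x → act typeB n (g xor h) x ≡ act typeB n g (act typeB n h x)
  act-xor false h x = refl
  act-xor true false x = refl
  act-xor true true x = sym (ℤₚ.neg-involutive x)

  act-involutive : ∀ g x → act typeB n g (act typeB n g x) ≡ x
  act-involutive false x = refl
  act-involutive true x = ℤₚ.neg-involutive x

  reduce : ℤ → Bool
  reduce (+ _) = false
  reduce -[1+ _ ] = true

  rep≡∣∣ : ∀ x → act typeB n (reduce x) x ≡ + ∣ x ∣
  rep≡∣∣ (+ _) = refl
  rep≡∣∣ -[1+ _ ] = refl

  fixes-0 : ∀ {σ} → Admissible typeB n σ → σ 0ℤ ≡ 0ℤ
  fixes-0 {σ} Aσ =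
    i+i≡0⇒i≡0 (σ 0ℤ) (trans (cong (_+ σ 0ℤ) (Admissible.equivariant Aσ true 0ℤ)) (ℤₚ.+-inverseˡ (σ 0ℤ)))

  symmetries : Symmetries typeB n
  symmetries = record
    { identity = false ; act-identity = λ _ → refl
    ; _·_ = _xor_ ; act-· = act-xor
    ; inverse = λ g → g ; act-inverse = act-involutive
    ; sign = λ g → g ; offset = λ _ → 0ℤ ; act-affine = affine
    ; orbit? = orbit? ; domain? = domain? ; act-domain = act-domain
    ; reduce = reduce ; rep-invariant = rep-invariant ; rep-window = rep-window
    ; rep-in-window-or-fixed = in-window-or-fixed }
    where
    affine : ∀ g x → act typeB n g x ≡ signed g x + 0ℤ
    affine false x = sym (ℤₚ.+-identityʳ x)
    affine true x = sym (ℤₚ.+-identityʳ (- x))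
    orbit? : ∀ x a → (Σ Bool λ g → x ≡ act typeB n g a) ⊎ (∀ g → x ≢ act typeB n g a)
    orbit? x a with x ℤₚ.≟ a | x ℤₚ.≟ - a
    ... | yes x≡a | _ = inj₁ (false , x≡a)
    ... | no _ | yes x≡-a = inj₁ (true , x≡-a)
    ... | no x≢a | no x≢-a = inj₂ λ { false → x≢a ; true → x≢-a }
    act-domain : ∀ g {x} → Domain typeB n x → Domain typeB n (act typeB n g x)
    act-domain false x∈D = x∈D
    act-domain true {x} x∈D = subst (λ m → (1 ℕ.≤ m) × (m ℕ.≤ n)) (sym (ℤₚ.∣-i∣≡∣i∣ x)) x∈D
    rep-invariant : ∀ g x → act typeB n (reduce (act typeB n g x)) (act typeB n g x) ≡ act typeB n (reduce x) x
    rep-invariant false x = refl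
    rep-invariant true x = trans (rep≡∣∣ (- x)) (trans (cong +_ (ℤₚ.∣-i∣≡∣i∣ x)) (sym (rep≡∣∣ x)))
    rep-window : ∀ i → Window n i → act typeB n (reduce i) i ≡ i
    rep-window (+ _) _ = refl
    rep-window -[1+ _ ] (() , _)
    in-window-or-fixed : ∀ {σ} → Admissible typeB n σ → ∀ x →
                         Window n (act typeB n (reduce x) x) ⊎ σ (act typeB n (reduce x) x) ≡ act typeB n (reduce x) x
    in-window-or-fixed {σ} Aσ x rewrite rep≡∣∣ x with ∣ x ∣ | domain? (+ ∣ x ∣)
    ... | zero | _ = inj₂ (fixes-0 Aσ)
    ... | suc k | yes (1≤k , k≤n) = inj₁ (ℤ.+≤+ 1≤k , ℤ.+≤+ k≤n)
    ... | suc k | no ∉D = inj₂ (Admissible.fixOutside Aσ (+ suc k) ∉D)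

  open AdmissibleMaps symmetries using (admissible-domain; moved⇒domain)

  ∣∣≤⇒bounded : ∀ {n} x → ∣ x ∣ ℕ.≤ n → (- + n ≤ x) × (x ≤ + n)
  ∣∣≤⇒bounded {zero} (+ zero) ℕ.z≤n = ℤₚ.≤-refl , ℤ.+≤+ ℕ.z≤n
  ∣∣≤⇒bounded {suc n} (+ k) k≤n = ℤ.-≤+ , ℤ.+≤+ k≤n
  ∣∣≤⇒bounded {suc n} -[1+ k ] (ℕ.s≤s k≤n) = ℤ.-≤- k≤n , ℤ.-≤+

  bounded⇒∣∣≤ : ∀ {n} x → - + n ≤ x → x ≤ + n → ∣ x ∣ ℕ.≤ n
  bounded⇒∣∣≤ (+ k) _ (ℤ.+≤+ k≤n) = k≤n
  bounded⇒∣∣≤ {suc n} -[1+ k ] (ℤ.-≤- k≤n) _ = ℕ.s≤s k≤n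

  admissible-box : ∀ {σ} → Admissible typeB n σ → ∀ x → - + n ≤ x → x ≤ + n → (- + n ≤ σ x) × (σ x ≤ + n)
  admissible-box Aσ x -n≤x x≤n with x ℤₚ.≟ 0ℤ
  ... | yes refl = subst (λ y → (- + n ≤ y) × (y ≤ + n)) (sym (fixes-0 Aσ)) (∣∣≤⇒bounded 0ℤ ℕ.z≤n)
  ... | no x≢0 = ∣∣≤⇒bounded _ (proj₂ (admissible-domain Aσ (1≤∣x∣ x x≢0 , bounded⇒∣∣≤ x -n≤x x≤n)))
    where
    1≤∣x∣ : ∀ x → x ≢ 0ℤ → 1 ℕ.≤ ∣ x ∣
    1≤∣x∣ (+ zero) x≢0 = ⊥-elim (x≢0 refl)
    1≤∣x∣ (+ suc _) _ = ℕ.s≤s ℕ.z≤n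
    1≤∣x∣ -[1+ _ ] _ = ℕ.s≤s ℕ.z≤n

  membership : Membership symmetries
  membership = boxedMembership symmetries (- + n) (+ n)
    (λ w∈W → record { InW w∈W ; equivariant = λ { false _ → refl ; true x → InW.symmetric w∈W x } })
    (λ Aw → record { Admissible Aw ; symmetric = Admissible.equivariant Aw true })
    admissible-box
    (λ Aσ σx≢x → ∣∣≤⇒bounded _ (proj₂ (moved⇒domain Aσ σx≢x)))

translation-equivariant : ∀ (f : ℤ → ℤ) P → (∀ x → f (x + P) ≡ f x + P) → ∀ k x → f (x + k * P) ≡ f x + k * P
translation-equivariant f P step = ℤ-induction _ base up down
  where
  eq₀ : ∀ x P → x + 0ℤ * P ≡ x
  eq₀ = solve-∀
  eq₁ : ∀ x k P → x + (1ℤ + k) * P ≡ (x + k * P) + P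
  eq₁ = solve-∀
  base : ∀ x → f (x + 0ℤ * P) ≡ f x + 0ℤ * P
  base x = trans (cong f (eq₀ x P)) (sym (eq₀ (f x) P))
  up : ∀ k → (∀ x → f (x + k * P) ≡ f x + k * P) → ∀ x → f (x + (1ℤ + k) * P) ≡ f x + (1ℤ + k) * P
  up k shift x = trans (cong f (eq₁ x k P)) (trans (step _) (trans (cong (_+ P) (shift x)) (sym (eq₁ (f x) k P))))
  down : ∀ k → (∀ x → f (x + (1ℤ + k) * P) ≡ f x + (1ℤ + k) * P) → ∀ x → f (x + k * P) ≡ f x + k * P
  down k shift x = ∙-cancelʳ P _ _
    (trans (sym (step _)) (trans (cong f (sym (eq₁ x k P))) (trans (shift x) (eq₁ (f x) k P))))

small-multiple : ∀ {N} k → - + N < k * + N → k * + N < + N → k ≡ 0ℤ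
small-multiple (+ zero) _ _ = refl
small-multiple {N} (+ suc j) _ kN<N =
  ⊥-elim (ℤₚ.<⇒≱ kN<N (subst (+ N ≤_) (ℤₚ.pos-* (suc j) N) (ℤ.+≤+ (ℕₚ.m≤m+n N (j ℕ.* N)))))
small-multiple {N} -[1+ j ] -N<kN _ =
  ⊥-elim (ℤₚ.<⇒≱ -N<kN (subst (_≤ - + N) (trans (cong -_ (ℤₚ.pos-* (suc j) N)) (ℤₚ.neg-distribˡ-* (+ suc j) (+ N)))
                                           (ℤₚ.neg-mono-≤ (ℤ.+≤+ (ℕₚ.m≤m+n N (j ℕ.* N))))))

multiple-within : ∀ {N} k → 1 ℕ.≤ N → 0ℤ ≤ k * + N → k * + N ≤ + N → k ≡ 0ℤ ⊎ k ≡ 1ℤ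
multiple-within (+ zero) _ _ _ = inj₁ refl
multiple-within (+ suc zero) _ _ _ = inj₂ refl
multiple-within {suc N} (+ suc (suc j)) _ _ (ℤ.+≤+ kN≤N) = ⊥-elim (ℕₚ.m+1+n≰m (suc N) kN≤N)
multiple-within {suc N} -[1+ j ] _ () _

translation-orbit? : ∀ N .{{_ : ℕ.NonZero N}} x a → (Σ ℤ λ k → x ≡ a + k * + N) ⊎ (∀ k → x ≢ a + k * + N)
translation-orbit? N x a with (x - a) %ℕ N | a≡a%ℕn+[a/ℕn]*n (x - a) N | n%ℕd<d (x - a) N
... | zero | x-a≡ | _ = inj₁ ((x - a) /ℕ N , trans (eq x a) (cong (λ d → a + d) (trans x-a≡ (ℤₚ.+-identityˡ _))))
  where
  eq : ∀ x a → x ≡ a + (x - a)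
  eq = solve-∀
... | suc r | x-a≡ | r<N = inj₂ λ k x≡a+kN → +suc≢0 (trans (sym (r≡ k x≡a+kN)) (cong (_* + N) (k-q≡0 k x≡a+kN)))
  where
  q = (x - a) /ℕ N
  +suc≢0 : + suc r ≢ 0ℤ
  +suc≢0 ()
  r≡ : ∀ k → x ≡ a + k * + N → (k - q) * + N ≡ + suc r
  r≡ k x≡ = begin
    (k - q) * + N            ≡⟨ eq a k q (+ N) ⟩
    (a + k * + N - a) - q * + N ≡⟨ cong (λ y → (y - a) - q * + N) x≡ ⟨
    (x - a) - q * + N        ≡⟨ cong (λ d → d - q * + N) x-a≡ ⟩
    (+ suc r + q * + N) - q * + N ≡⟨ eq′ (+ suc r) (q * + N) ⟩
    + suc r                  ∎
    where
    open ≡-Reasoning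
    eq : ∀ a k q N → (k - q) * N ≡ (a + k * N - a) - q * N
    eq = solve-∀
    eq′ : ∀ r s → (r + s) - s ≡ r
    eq′ = solve-∀
  k-q≡0 : ∀ k → x ≡ a + k * + N → k - q ≡ 0ℤ
  k-q≡0 k x≡ = small-multiple (k - q)
    (subst (- + N <_) (sym (r≡ k x≡)) (ℤₚ.≤-<-trans (ℤₚ.neg-mono-≤ (ℤ.+≤+ ℕ.z≤n)) (ℤ.+<+ ℕ.z<s)))
    (subst (_< + N) (sym (r≡ k x≡)) (ℤ.+<+ r<N))

module TypeÃ (n′ : ℕ) where

  n : ℕ
  n = suc n′

  N : ℤ
  N = + n

  _⊙_ : ℤ → ℤ → ℤ
  _⊙_ = act typeÃ n

  window-translate-unique : ∀ {y y′} k → Window n y → Window n y′ → y′ ≡ y + k * N → y′ ≡ y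
  window-translate-unique {y} {y′} k (1≤y , y≤n) (1≤y′ , y′≤n) y′≡ =
    trans y′≡ (trans (cong (λ j → y + j * N) k≡0) (eq₀ y N))
    where
    eq₀ : ∀ y N → y + 0ℤ * N ≡ y
    eq₀ = solve-∀
    kN≡ : k * N ≡ y′ - y
    kN≡ = trans (eq₁ y (k * N)) (cong (_- y) (sym y′≡))
      where
      eq₁ : ∀ y d → d ≡ y + d - y
      eq₁ = solve-∀
    k≡0 : k ≡ 0ℤ
    k≡0 = small-multiple k
      (subst (- N <_) (sym kN≡) (<-by (0≤-+ (ℤₚ.i≤j⇒0≤j-i 1≤y′) (ℤₚ.i≤j⇒0≤j-i y≤n)) (eq₂ y y′ N)))
      (subst (_< N) (sym kN≡) (<-by (0≤-+ (ℤₚ.i≤j⇒0≤j-i 1≤y) (ℤₚ.i≤j⇒0≤j-i y′≤n)) (eq₃ y y′ N)))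
      where
      eq₂ : ∀ y y′ N → (y′ - + 1) + (N - y) ≡ (y′ - y) - - N - 1ℤ
      eq₂ = solve-∀
      eq₃ : ∀ y y′ N → (y - + 1) + (N - y′) ≡ N - (y′ - y) - 1ℤ
      eq₃ = solve-∀

  reduce : ℤ → ℤ
  reduce x = - ((x - 1ℤ) /ℕ n)

  rep≡ : ∀ x → reduce x ⊙ x ≡ + suc ((x - 1ℤ) %ℕ n)
  rep≡ x = begin
    x + reduce x * N                           ≡⟨ eq₁ x (reduce x * N) ⟩
    (x - 1ℤ) + 1ℤ + reduce x * N               ≡⟨ cong (λ d → d + 1ℤ + reduce x * N) (a≡a%ℕn+[a/ℕn]*n (x - 1ℤ) n) ⟩
    (+ r + q * N) + 1ℤ + (- q) * N             ≡⟨ eq₂ (+ r) q N ⟩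
    1ℤ + + r                                   ≡⟨ ℤₚ.pos-+ 1 r ⟨
    + suc r                                    ∎
    where
    open ≡-Reasoning
    r = (x - 1ℤ) %ℕ n
    q = (x - 1ℤ) /ℕ n
    eq₁ : ∀ x d → x + d ≡ (x - 1ℤ) + 1ℤ + d
    eq₁ = solve-∀
    eq₂ : ∀ r q N → (r + q * N) + 1ℤ + (- q) * N ≡ 1ℤ + r
    eq₂ = solve-∀

  rep-in-window : ∀ x → Window n (reduce x ⊙ x)
  rep-in-window x = subst (Window n) (sym (rep≡ x)) (+suc∈Window (n%ℕd<d (x - 1ℤ) n))

  symmetries : Symmetries typeÃ n
  symmetries = record
    { identity = 0ℤ ; act-identity = λ x → eq₀ x N
    ; _·_ = _+_ ; act-· = λ g h x → eq₁ g h x N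
    ; inverse = -_ ; act-inverse = λ g x → eq₂ g x N
    ; sign = λ _ → false ; offset = λ g → g * N ; act-affine = λ _ _ → refl
    ; orbit? = translation-orbit? n ; domain? = λ _ → yes tt ; act-domain = λ _ _ → tt
    ; reduce = reduce
    ; rep-invariant = λ g x → window-translate-unique (g + reduce (g ⊙ x) - reduce x) (rep-in-window x) (rep-in-window (g ⊙ x))
                                (eq₃ x g (reduce (g ⊙ x)) (reduce x) N)
    ; rep-window = λ i i∈W → window-translate-unique (reduce i) i∈W (rep-in-window i) refl
    ; rep-in-window-or-fixed = λ _ x → inj₁ (rep-in-window x) }
    where
    eq₀ : ∀ x N → x + 0ℤ * N ≡ x
    eq₀ = solve-∀
    eq₁ : ∀ g h x N → x + (g + h) * N ≡ (x + h * N) + g * N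
    eq₁ = solve-∀
    eq₂ : ∀ g x N → (x + g * N) + (- g) * N ≡ x
    eq₂ = solve-∀
    eq₃ : ∀ x g r′ r N → (x + g * N) + r′ * N ≡ (x + r * N) + (g + r′ - r) * N
    eq₃ = solve-∀

  open AdmissibleMaps symmetries using (Invariant; module InvariantSums)
  open InvariantSums ℤₚ.+-0-commutativeMonoid using () renaming (Σ<-admissible to Σℤ-admissible)

  DriftFree : (ℤ → ℤ) → Set
  DriftFree σ = segmentSum 1ℤ n (drift σ) ≡ 0ℤ

  drift-invariant : ∀ {σ} → Admissible typeÃ n σ → Invariant (drift σ)
  drift-invariant {σ} Aσ g x = trans (cong (_- g ⊙ x) (Admissible.equivariant Aσ g x)) (eq (σ x) x (g * N))
    where
    eq : ∀ s x c → (s + c) - (x + c) ≡ s - x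
    eq = solve-∀

  drift-periodic : ∀ {σ} → Admissible typeÃ n σ → ∀ x → drift σ (x + N) ≡ drift σ x
  drift-periodic {σ} Aσ x = trans (cong (λ c → drift σ (x + c)) (sym (ℤₚ.*-identityˡ N))) (drift-invariant Aσ 1ℤ x)

  involution-drift-free : ∀ {t} → Admissible typeÃ n t → Involutive t → DriftFree t
  involution-drift-free {t} At t-involutive = i+i≡0⇒i≡0 S (begin
    S + S                                         ≡⟨ cong (λ s → S + s) reflected ⟩
    S + - S                                       ≡⟨ ℤₚ.+-inverseʳ S ⟩
    0ℤ                                            ∎)
    where
    open ≡-Reasoning
    S = segmentSum 1ℤ n (drift t)
    flip : ∀ y → drift t (t y) ≡ - drift t y
    flip y = trans (cong (_- t y) (t-involutive y)) (eq y (t y))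
      where
      eq : ∀ y z → y - z ≡ - (z - y)
      eq = solve-∀
    reflected : S ≡ - S
    reflected = trans (Σℤ-admissible At (drift t) (drift-invariant At))
                      (trans (Σℤ-cong n (λ k _ → flip (+ suc k))) (Σℤ-neg n (λ k → drift t (+ suc k))))

  ∘-involution-drift-free : ∀ {w t} → Admissible typeÃ n w → DriftFree w → Admissible typeÃ n t → Involutive t →
                            DriftFree (w ∘ t)
  ∘-involution-drift-free {w} {t} Aw w-drift-free At t-involutive = begin
    segmentSum 1ℤ n (drift (w ∘ t))
      ≡⟨ Σℤ-cong n (λ k _ → eq (w (t (+ suc k))) (t (+ suc k)) (+ suc k)) ⟩
    Σℤ n (λ k → drift w (t (+ suc k)) + drift t (+ suc k))
      ≡⟨ Σℤ-distrib n (λ k → drift w (t (+ suc k))) (λ k → drift t (+ suc k)) ⟩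
    Σℤ n (λ k → drift w (t (+ suc k))) + segmentSum 1ℤ n (drift t)
      ≡⟨ cong₂ _+_ (sym (Σℤ-admissible At (drift w) (drift-invariant Aw))) (involution-drift-free At t-involutive) ⟩
    segmentSum 1ℤ n (drift w) + 0ℤ
      ≡⟨ cong (_+ 0ℤ) w-drift-free ⟩
    0ℤ ∎
    where
    open ≡-Reasoning
    eq : ∀ a b c → a - c ≡ (a - b) + (b - c)
    eq = solve-∀

  every-segment-drift-free : ∀ {σ} → Admissible typeÃ n σ → DriftFree σ → ∀ a → segmentSum a n (drift σ) ≡ 0ℤ
  every-segment-drift-free Aσ drift-free a = trans (periodic-segmentSum _ n (drift-periodic Aσ) a 1ℤ) drift-free

  membership : Membership symmetries
  membership = record
    { SideCondition = DriftFree
    ; fromInW = λ w∈W → admissible w∈W , from-sum w∈W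
    ; toInW = λ Aw w-drift-free → record { Admissible Aw ; symmetric = shift Aw , to-sum Aw w-drift-free }
    ; side-involution = involution-drift-free
    ; side-∘-involution = ∘-involution-drift-free
    ; rising-balanced = λ {σ} Aσ σ-drift-free {p} _ →
        drift-free-rising {σ = σ} {P = n} ℕ.z<s (every-segment-drift-free Aσ σ-drift-free) p
    ; falling-balanced = λ {σ} Aσ σ-drift-free {q} _ →
        drift-free-falling {σ = σ} {P = n} ℕ.z<s (every-segment-drift-free Aσ σ-drift-free) q
    }
    where
    admissible : ∀ {w} → InW typeÃ n w → Admissible typeÃ n w
    admissible {w} w∈W = record { InW w∈W ; equivariant = translation-equivariant w N (proj₁ (InW.symmetric w∈W)) }
    from-sum : ∀ {w} → InW typeÃ n w → DriftFree w
    from-sum {w} w∈W = begin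
      segmentSum 1ℤ n (drift w)                ≡⟨ segmentSum-drift w 1ℤ n ⟩
      segmentSum 1ℤ n w - arithSum 1ℤ n        ≡⟨ cong₂ _-_ (trans (sym (sumℤ≡segmentSum n w)) (proj₂ (InW.symmetric w∈W)))
                                                               (arithSum-from-1 n) ⟩
      + (suc n C 2) - + (suc n C 2)            ≡⟨ ℤₚ.+-inverseʳ (+ (suc n C 2)) ⟩
      0ℤ                                       ∎
      where open ≡-Reasoning
    shift : ∀ {w} → Admissible typeÃ n w → ∀ x → w (x + N) ≡ w x + N
    shift {w} Aw x = trans (cong (λ c → w (x + c)) (sym (ℤₚ.*-identityˡ N)))
                           (trans (Admissible.equivariant Aw 1ℤ x) (cong (λ c → w x + c) (ℤₚ.*-identityˡ N)))
    to-sum : ∀ {w} → Admissible typeÃ n w → DriftFree w → sumℤ n w ≡ + (suc n C 2)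
    to-sum {w} Aw w-drift-free = trans (sumℤ≡segmentSum n w) (trans
      (ℤₚ.i-j≡0⇒i≡j _ _ (trans (sym (segmentSum-drift w 1ℤ n)) w-drift-free)) (arithSum-from-1 n))

module TypeC̃ (n : ℕ) where

  N′ : ℕ
  N′ = 2 ℕ.* n ℕ.+ 2

  instance
    N′-nonZero : ℕ.NonZero N′
    N′-nonZero = subst ℕ.NonZero (ℕₚ.+-comm 2 (2 ℕ.* n)) _

  N : ℤ
  N = + N′

  ν : ℤ
  ν = + n

  N≡ : N ≡ ν + ν + + 2
  N≡ = trans (ℤₚ.pos-+ (2 ℕ.* n) 2)
             (cong (_+ + 2) (trans (ℤₚ.pos-+ n (n ℕ.+ 0)) (cong (λ m → ν + + m) (ℕₚ.+-identityʳ n))))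

  infixr 9 _⊙_
  _⊙_ : Bool × ℤ → ℤ → ℤ
  _⊙_ = act typeC̃ n

  1≤N′ : 1 ℕ.≤ N′
  1≤N′ = subst (1 ℕ.≤_) (ℕₚ.+-comm 2 (2 ℕ.* n)) (ℕ.s≤s ℕ.z≤n)

  -- Every orbit meets [0, n + 1] exactly once; 0 and n + 1 are fixed by every admissible map.
  Fundamental : ℤ → Set
  Fundamental y = (0ℤ ≤ y) × (y ≤ ν + 1ℤ)

  fundamental-translate : ∀ k {y y′} → Fundamental y → Fundamental y′ → y′ ≡ y + k * N → y′ ≡ y
  fundamental-translate k {y} {y′} (0≤y , y≤ν+1) (0≤y′ , y′≤ν+1) y′≡ =
    trans y′≡ (trans (cong (λ j → y + j * N) k≡0) (eq₀ y N))
    where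
    eq₀ : ∀ y N → y + 0ℤ * N ≡ y
    eq₀ = solve-∀
    kN≡ : k * N ≡ y′ - y
    kN≡ = trans (eq₁ y (k * N)) (cong (_- y) (sym y′≡))
      where
      eq₁ : ∀ y d → d ≡ y + d - y
      eq₁ = solve-∀
    eq₂ : ∀ y y′ ν → y′ + (ν + 1ℤ - y) + ν ≡ (y′ - y) - - (ν + ν + + 2) - 1ℤ
    eq₂ = solve-∀
    eq₃ : ∀ y y′ ν → (ν + 1ℤ - y′) + y + ν ≡ (ν + ν + + 2) - (y′ - y) - 1ℤ
    eq₃ = solve-∀
    k≡0 : k ≡ 0ℤ
    k≡0 = small-multiple k
      (subst (- N <_) (sym kN≡) (<-by (0≤-+ (0≤-+ 0≤y′ (ℤₚ.i≤j⇒0≤j-i y≤ν+1)) (0≤+ n))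
        (trans (eq₂ y y′ ν) (cong (λ M → (y′ - y) - - M - 1ℤ) (sym N≡)))))
      (subst (_< N) (sym kN≡) (<-by (0≤-+ (0≤-+ (ℤₚ.i≤j⇒0≤j-i y′≤ν+1) 0≤y) (0≤+ n))
        (trans (eq₃ y y′ ν) (cong (λ M → M - (y′ - y) - 1ℤ) (sym N≡)))))
  fundamental-reflect : ∀ k {y y′} → Fundamental y → Fundamental y′ → y′ ≡ - y + k * N → y′ ≡ y
  fundamental-reflect k {y} {y′} (0≤y , y≤ν+1) (0≤y′ , y′≤ν+1) y′≡
    with multiple-within k 1≤N′ (subst (0ℤ ≤_) (sym kN≡) (0≤-+ 0≤y 0≤y′)) (subst (_≤ N) (sym kN≡) y+y′≤N)
    where
    kN≡ : k * N ≡ y + y′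
    kN≡ = trans (eq y (k * N)) (cong (λ z → y + z) (sym y′≡))
      where
      eq : ∀ y d → d ≡ y + (- y + d)
      eq = solve-∀
    y+y′≤N : y + y′ ≤ N
    y+y′≤N = ≤-by (0≤-+ (ℤₚ.i≤j⇒0≤j-i y≤ν+1) (ℤₚ.i≤j⇒0≤j-i y′≤ν+1))
               (trans (eq y y′ ν) (cong (λ M → M - (y + y′)) (sym N≡)))
      where
      eq : ∀ y y′ ν → (ν + 1ℤ - y) + (ν + 1ℤ - y′) ≡ (ν + ν + + 2) - (y + y′)
      eq = solve-∀
  ... | inj₁ refl = trans y′≡ (trans (cong (λ z → - z + 0ℤ) y≡0) (sym y≡0))
    where
    y≡0 : y ≡ 0ℤ
    y≡0 = ℤₚ.≤-antisym (≤-by 0≤y′ (trans y′≡ (eq y))) 0≤y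
      where
      eq : ∀ y → - y + 0ℤ ≡ 0ℤ - y
      eq = solve-∀
  ... | inj₂ refl = trans y′≡ (trans (cong (λ z → - z + 1ℤ * N) y≡ν+1) (trans (reflect-ν+1) (sym y≡ν+1)))
    where
    reflect-ν+1 : - (ν + 1ℤ) + 1ℤ * N ≡ ν + 1ℤ
    reflect-ν+1 = trans (cong (λ M → - (ν + 1ℤ) + 1ℤ * M) N≡) (eq ν)
      where
      eq : ∀ ν → - (ν + 1ℤ) + 1ℤ * (ν + ν + + 2) ≡ ν + 1ℤ
      eq = solve-∀
    y≡ν+1 : y ≡ ν + 1ℤ
    y≡ν+1 = ℤₚ.≤-antisym y≤ν+1 (≤-by (ℤₚ.i≤j⇒0≤j-i y′≤ν+1)
      (trans (cong (λ z → ν + 1ℤ - z) y′≡) (trans (cong (λ M → ν + 1ℤ - (- y + 1ℤ * M)) N≡) (eq y ν))))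
      where
      eq : ∀ y ν → ν + 1ℤ - (- y + 1ℤ * (ν + ν + + 2)) ≡ y - (ν + 1ℤ)
      eq = solve-∀

  fundamental-unique : ∀ g {y y′} → Fundamental y → Fundamental y′ → y′ ≡ g ⊙ y → y′ ≡ y
  fundamental-unique (false , k) = fundamental-translate k
  fundamental-unique (true , k) = fundamental-reflect k

  signed-not : ∀ s x → signed (not s) x ≡ - signed s x
  signed-not false x = refl
  signed-not true x = sym (ℤₚ.neg-involutive x)

  _·_ : Bool × ℤ → Bool × ℤ → Bool × ℤ
  (false , k) · (s , k′) = s , k′ + k
  (true , k) · (s , k′) = not s , - k′ + k

  act-affine : ∀ g x → g ⊙ x ≡ signed (proj₁ g) x + proj₂ g * N
  act-affine (false , k) x = refl
  act-affine (true , k) x = refl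

  act-· : ∀ g h x → (g · h) ⊙ x ≡ g ⊙ h ⊙ x
  act-· (false , k) (s , k′) x =
    trans (act-affine (s , k′ + k) x) (trans (eq (signed s x) k k′ N) (cong (_+ k * N) (sym (act-affine (s , k′) x))))
    where
    eq : ∀ z k k′ N → z + (k′ + k) * N ≡ (z + k′ * N) + k * N
    eq = solve-∀
  act-· (true , k) (s , k′) x = trans (act-affine (not s , - k′ + k) x) (trans (cong (_+ (- k′ + k) * N) (signed-not s x))
    (trans (eq (signed s x) k k′ N) (cong (λ y → - y + k * N) (sym (act-affine (s , k′) x)))))
    where
    eq : ∀ z k k′ N → - z + (- k′ + k) * N ≡ - (z + k′ * N) + k * N
    eq = solve-∀

  inverse : Bool × ℤ → Bool × ℤ
  inverse (false , k) = false , - k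
  inverse (true , k) = true , k

  act-inverse : ∀ g x → inverse g ⊙ g ⊙ x ≡ x
  act-inverse (false , k) x = eq x k N
    where
    eq : ∀ x k N → (x + k * N) + (- k) * N ≡ x
    eq = solve-∀
  act-inverse (true , k) x = eq x k N
    where
    eq : ∀ x k N → - (- x + k * N) + k * N ≡ x
    eq = solve-∀

  orbit? : ∀ x a → (Σ (Bool × ℤ) λ g → x ≡ g ⊙ a) ⊎ (∀ g → x ≢ g ⊙ a)
  orbit? x a with translation-orbit? N′ x a | translation-orbit? N′ x (- a)
  ... | inj₁ (k , x≡) | _ = inj₁ ((false , k) , x≡)
  ... | inj₂ _ | inj₁ (k , x≡) = inj₁ ((true , k) , x≡)
  ... | inj₂ x∉a+NZ | inj₂ x∉-a+NZ = inj₂ λ { (false , k) → x∉a+NZ k ; (true , k) → x∉-a+NZ k }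

  reduce-by : ℤ → (m : ℕ) → Dec (m ℕ.≤ suc n) → Bool × ℤ
  reduce-by q m (yes _) = false , - q
  reduce-by q m (no _) = true , 1ℤ + q

  reduce : ℤ → Bool × ℤ
  reduce x = reduce-by (x /ℕ N′) (x %ℕ N′) (x %ℕ N′ ℕₚ.≤? suc n)

  rep-fundamental : ∀ x → Fundamental (reduce x ⊙ x)
  rep-fundamental x = by (x %ℕ N′ ℕₚ.≤? suc n)
    where
    m = x %ℕ N′
    q = x /ℕ N′
    x≡ : x ≡ + m + q * N
    x≡ = a≡a%ℕn+[a/ℕn]*n x N′
    by : (d : Dec (m ℕ.≤ suc n)) → Fundamental (reduce-by q m d ⊙ x)
    by (yes m≤n+1) = subst Fundamental (sym (trans (cong (λ y → y + - q * N) x≡) (eq (+ m) q N)))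
                       (0≤+ m , subst (+ m ≤_) (ℤₚ.pos-+ n 1) (ℤ.+≤+ (subst (m ℕ.≤_) (ℕₚ.+-comm 1 n) m≤n+1)))
      where
      eq : ∀ m q N → (m + q * N) + - q * N ≡ m
      eq = solve-∀
    by (no m≰n+1) = subst Fundamental (sym (trans (cong (λ y → - y + (1ℤ + q) * N) x≡) (eq (+ m) q N)))
                      (ℤₚ.i≤j⇒0≤j-i (ℤₚ.<⇒≤ (ℤ.+<+ (n%ℕd<d x N′))) ,
                       ≤-by (0≤-+ (i<j⇒0≤j-i-1 (ℤ.+<+ (ℕₚ.≰⇒> m≰n+1))) (0≤+ 1))
                            (trans (cong (λ z → (+ m - z - 1ℤ) + + 1) (ℤₚ.pos-+ 1 n))
                              (trans (eq′ (+ m) ν) (cong (λ M → ν + 1ℤ - (M - + m)) (sym N≡)))))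
      where
      eq : ∀ m q N → - (m + q * N) + (1ℤ + q) * N ≡ N - m
      eq = solve-∀
      eq′ : ∀ m ν → (m - (1ℤ + ν) - 1ℤ) + + 1 ≡ ν + 1ℤ - ((ν + ν + + 2) - m)
      eq′ = solve-∀

  window⇒fundamental : ∀ {y} → Window n y → Fundamental y
  window⇒fundamental {y} (1≤y , y≤n) = ℤₚ.≤-trans (0≤+ 1) 1≤y , ≤-by (0≤-+ (ℤₚ.i≤j⇒0≤j-i y≤n) (0≤+ 1)) (eq ν y)
    where
    eq : ∀ ν y → (ν - y) + + 1 ≡ ν + 1ℤ - y
    eq = solve-∀

  fundamental⇒window : ∀ {y} → Fundamental y → y ≢ 0ℤ → y ≢ ν + 1ℤ → Window n y
  fundamental⇒window {y} (0≤y , y≤ν+1) y≢0 y≢ν+1 =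
    ℤₚ.i<j⇒suc[i]≤j (ℤₚ.≤∧≢⇒< 0≤y (y≢0 ∘ sym)) , ≤-by (i<j⇒0≤j-i-1 (ℤₚ.≤∧≢⇒< y≤ν+1 y≢ν+1)) (eq ν y)
    where
    eq : ∀ ν y → ν + 1ℤ - y - 1ℤ ≡ ν - y
    eq = solve-∀

  module _ {σ} (Aσ : Admissible typeC̃ n σ) where

    open Admissible Aσ

    admissible-odd : ∀ x → σ (- x) ≡ - σ x
    admissible-odd x =
      trans (cong σ (sym (ℤₚ.+-identityʳ (- x)))) (trans (equivariant (true , 0ℤ) x) (ℤₚ.+-identityʳ (- σ x)))

    admissible-shift : ∀ x → σ (x + N) ≡ σ x + N
    admissible-shift x = trans (cong (λ c → σ (x + c)) (sym (ℤₚ.*-identityˡ N)))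
                               (trans (equivariant (false , 1ℤ) x) (cong (λ c → σ x + c) (ℤₚ.*-identityˡ N)))

    fixes-0 : σ 0ℤ ≡ 0ℤ
    fixes-0 = i+i≡0⇒i≡0 (σ 0ℤ) (trans (cong (_+ σ 0ℤ) (admissible-odd 0ℤ)) (ℤₚ.+-inverseˡ (σ 0ℤ)))

    fixes-ν+1 : σ (ν + 1ℤ) ≡ ν + 1ℤ
    fixes-ν+1 = ℤₚ.i-j≡0⇒i≡j _ _ (i+i≡0⇒i≡0 (σ a - a) (begin
      (σ a - a) + (σ a - a)                     ≡⟨ eq (σ a) a N ⟩
      (σ a - (- σ a + 1ℤ * N)) + (1ℤ * N - (a + a)) ≡⟨ cong₂ _+_ σa-reflected twice-a ⟩
      0ℤ + 0ℤ                                   ∎))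
      where
      open ≡-Reasoning
      a = ν + 1ℤ
      eq : ∀ s a N → (s - a) + (s - a) ≡ (s - (- s + 1ℤ * N)) + (1ℤ * N - (a + a))
      eq = solve-∀
      a-reflected : (true , 1ℤ) ⊙ a ≡ a
      a-reflected = trans (cong (λ M → - a + 1ℤ * M) N≡) (eq′ ν)
        where
        eq′ : ∀ ν → - (ν + 1ℤ) + 1ℤ * (ν + ν + + 2) ≡ ν + 1ℤ
        eq′ = solve-∀
      σa-reflected : σ a - (- σ a + 1ℤ * N) ≡ 0ℤ
      σa-reflected = trans (cong (λ y → y - (- σ a + 1ℤ * N)) (trans (cong σ (sym a-reflected)) (equivariant (true , 1ℤ) a)))
                           (ℤₚ.+-inverseʳ (- σ a + 1ℤ * N))
      twice-a : 1ℤ * N - (a + a) ≡ 0ℤ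
      twice-a = trans (cong (λ M → 1ℤ * M - (a + a)) N≡) (eq′ ν)
        where
        eq′ : ∀ ν → 1ℤ * (ν + ν + + 2) - ((ν + 1ℤ) + (ν + 1ℤ)) ≡ 0ℤ
        eq′ = solve-∀

    -- Odd and N-periodic drift sums to 0 over any period, since reflecting a
    -- period negates its sum.
    every-segment-drift-free : ∀ a → segmentSum a N′ (drift σ) ≡ 0ℤ
    every-segment-drift-free a = i+i≡0⇒i≡0 (S a) (begin
      S a + S a       ≡⟨ cong (λ s → S a + s) reflected ⟩
      S a + - S a     ≡⟨ ℤₚ.+-inverseʳ (S a) ⟩
      0ℤ              ∎)
      where
      open ≡-Reasoning
      S : ℤ → ℤ
      S b = segmentSum b N′ (drift σ)
      drift-odd : ∀ x → drift σ (- x) ≡ - drift σ x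
      drift-odd x = trans (cong (λ y → y - - x) (admissible-odd x)) (eq (σ x) x)
        where
        eq : ∀ s x → - s - - x ≡ - (s - x)
        eq = solve-∀
      drift-periodic : ∀ x → drift σ (x + N) ≡ drift σ x
      drift-periodic x = trans (cong (λ y → y - (x + N)) (admissible-shift x)) (eq (σ x) x N)
        where
        eq : ∀ s x N → (s + N) - (x + N) ≡ s - x
        eq = solve-∀
      c = 1ℤ - (a + N)
      reflected : S a ≡ - S a
      reflected = begin
        S a                                     ≡⟨ segmentSum-reflect N′ a (drift σ) ⟩
        segmentSum c N′ (drift σ ∘ -_)          ≡⟨ Σℤ-cong N′ (λ k _ → drift-odd (c + + k)) ⟩
        Σℤ N′ (λ k → - drift σ (c + + k))       ≡⟨ Σℤ-neg N′ (λ k → drift σ (c + + k)) ⟩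
        - S c                                   ≡⟨ cong -_ (periodic-segmentSum (drift σ) N′ drift-periodic c a) ⟩
        - S a                                   ∎

  symmetries : Symmetries typeC̃ n
  symmetries = record
    { identity = false , 0ℤ ; act-identity = λ x → eq₀ x N
    ; _·_ = _·_ ; act-· = act-·
    ; inverse = inverse ; act-inverse = act-inverse
    ; sign = proj₁ ; offset = λ g → proj₂ g * N ; act-affine = act-affine
    ; orbit? = orbit? ; domain? = λ _ → yes tt ; act-domain = λ _ _ → tt
    ; reduce = reduce
    ; rep-invariant = λ g x → fundamental-unique ((reduce (g ⊙ x) · g) · inverse (reduce x))
                                (rep-fundamental x) (rep-fundamental (g ⊙ x)) (translate g x)
    ; rep-window = λ i i∈W → fundamental-unique (reduce i) (window⇒fundamental i∈W) (rep-fundamental i) refl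
    ; rep-in-window-or-fixed = in-window-or-fixed }
    where
    eq₀ : ∀ x N → x + 0ℤ * N ≡ x
    eq₀ = solve-∀
    translate : ∀ g x → reduce (g ⊙ x) ⊙ g ⊙ x ≡ ((reduce (g ⊙ x) · g) · inverse (reduce x)) ⊙ reduce x ⊙ x
    translate g x = begin
      reduce (g ⊙ x) ⊙ g ⊙ x                                         ≡⟨ act-· (reduce (g ⊙ x)) g x ⟨
      (reduce (g ⊙ x) · g) ⊙ x                                       ≡⟨ cong ((reduce (g ⊙ x) · g) ⊙_) (act-inverse (reduce x) x) ⟨
      (reduce (g ⊙ x) · g) ⊙ inverse (reduce x) ⊙ reduce x ⊙ x       ≡⟨ act-· (reduce (g ⊙ x) · g) (inverse (reduce x)) (reduce x ⊙ x) ⟨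
      ((reduce (g ⊙ x) · g) · inverse (reduce x)) ⊙ reduce x ⊙ x     ∎
      where open ≡-Reasoning
    in-window-or-fixed : ∀ {σ} → Admissible typeC̃ n σ → ∀ x →
                         Window n (reduce x ⊙ x) ⊎ σ (reduce x ⊙ x) ≡ reduce x ⊙ x
    in-window-or-fixed {σ} Aσ x with reduce x ⊙ x ℤₚ.≟ 0ℤ | reduce x ⊙ x ℤₚ.≟ ν + 1ℤ
    ... | yes y≡0 | _ = inj₂ (trans (cong σ y≡0) (trans (fixes-0 Aσ) (sym y≡0)))
    ... | no _ | yes y≡ν+1 = inj₂ (trans (cong σ y≡ν+1) (trans (fixes-ν+1 Aσ) (sym y≡ν+1)))
    ... | no y≢0 | no y≢ν+1 = inj₁ (fundamental⇒window (rep-fundamental x) y≢0 y≢ν+1)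

  membership : Membership symmetries
  membership = record
    { SideCondition = λ _ → ⊤
    ; fromInW = λ w∈W → admissible w∈W , tt
    ; toInW = λ Aw _ → record { Admissible Aw ; symmetric = admissible-odd Aw , admissible-shift Aw }
    ; side-involution = λ _ _ → tt
    ; side-∘-involution = λ _ _ _ _ → tt
    ; rising-balanced = λ {σ} Aσ _ {p} _ → drift-free-rising {σ = σ} {P = N′} 1≤N′ (every-segment-drift-free Aσ) p
    ; falling-balanced = λ {σ} Aσ _ {q} _ → drift-free-falling {σ = σ} {P = N′} 1≤N′ (every-segment-drift-free Aσ) q
    }
    where
    admissible : ∀ {w} → InW typeC̃ n w → Admissible typeC̃ n w
    admissible {w} w∈W = record { InW w∈W ; equivariant = equivariant }
      where
      odd = proj₁ (InW.symmetric w∈W)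
      shift = proj₂ (InW.symmetric w∈W)
      equivariant : ∀ g x → w (g ⊙ x) ≡ g ⊙ w x
      equivariant (false , k) x = translation-equivariant w N shift k x
      equivariant (true , k) x = trans (translation-equivariant w N shift k (- x)) (cong (_+ k * N) (odd x))

theorem3p1 : (T : GeorgeType) (n : ℕ) → 1 ℕ.≤ n → (w : ℤ → ℤ) → InW T n w →
    DoubledCost T n w (tvd n w)
theorem3p1 typeA n _ = CostEqualsDisplacement.doubledCost≡tvd (TypeA.membership n)
theorem3p1 typeB n _ = CostEqualsDisplacement.doubledCost≡tvd (TypeB.membership n)
theorem3p1 typeÃ (suc n′) _ = CostEqualsDisplacement.doubledCost≡tvd (TypeÃ.membership n′)
theorem3p1 typeC̃ n _ = CostEqualsDisplacement.doubledCost≡tvd (TypeC̃.membership n)
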